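{- Let $p\equiv 2\pmod 3$ be a prime, let $\ell$ be a prime, and let $\mathcal{O}=\mathbb{Z}+\mathbb{Z}\frac{1+i}{2}+\mathbb{Z}\frac{i+k}{3}+\mathbb{Z}\frac{j+k}{2}$ in the quaternion algebra $\mathbb{Q}+\mathbb{Q}i+\mathbb{Q}j+\mathbb{Q}k$ with $i^2=-3$, $j^2=-p$, $k=ij=-ji$. Put $\epsilon=\frac{1+i}{2}$ and $\bar\epsilon=\frac{1-i}{2}$. Suppose $p>3\ell^2$. $(1)$ If $\mu\in\ell^{ -1}\mathcal{O}$ satisfies $\mathrm{Nrd}(\mu)=1$ and $\mu\notin\{\pm1,\pm\epsilon,\pm\bar\epsilon\}$, then $\ell\equiv 1\pmod 3$ and $\mu=\ell^{ -1}(x+y\epsilon)$ for some $(x,y)\in\mathbb{Z}^2$ with $\ell\nmid x$ and $x^2+xy+y^2=\ell^2$. $(2)$ If $s\in\ell^{ -1}\mathcal{O}$ satisfies $s^2=-p$ and $s\notin\{\pm j,\pm\epsilon j,\pm\bar\epsilon j\}$, then $\ell\equiv 1\pmod 3$ and $s=\ell^{ -1}(x+y\epsilon)j$ for some $(x,y)\in\mathbb{Z}^2$ with $\ell\nmid x$ and $x^2+xy+y^2=\ell^2$.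
   Context: The reduced norm of $a_1+a_2i+a_3j+a_4k$ in this quaternion algebra (which is the quaternion algebra over $\mathbb{Q}$ ramified exactly at $p$ and $\infty$) is $\mathrm{Nrd}=a_1^2+3a_2^2+pa_3^2+3pa_4^2$. The order $\mathcal{O}$ is the endomorphism ring of the supersingular curve $y^2=x^3+1$ over $\overline{\mathbb{F}}_p$. -}

module Defs where

open import Data.Nat using (ℕ; zero; suc)
open import Data.Integer using (ℤ; +_)
open import Data.Rational using (ℚ; 0ℚ; 1ℚ; _/_; _+_; _*_; -_; _-_)
open import Data.Product using (Σ; _×_; _,_)
open import Relation.Binary.PropositionalEquality using (_≡_)

record Quat : Set where
  constructor quat
  field
    re ci cj ck : ℚ
open Quat public

sc : ℚ → Quat
sc q = quat q 0ℚ 0ℚ 0ℚ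

ℤ→ℚ : ℤ → ℚ
ℤ→ℚ z = z / 1

_⊕_ : Quat → Quat → Quat
quat a b c d ⊕ quat a' b' c' d' = quat (a + a') (b + b') (c + c') (d + d')

neg : Quat → Quat
neg (quat a b c d) = quat (- a) (- b) (- c) (- d)

_·_ : ℚ → Quat → Quat
r · quat a b c d = quat (r * a) (r * b) (r * c) (r * d)

-- multiplication in the quaternion algebra with i² = -3, j² = -p, k = ij = -ji
-- (hence k² = -3p, ik = -3j, ki = 3j, jk = p i, kj = -p i)
mul : ℕ → Quat → Quat → Quat
mul p (quat a b c d) (quat a' b' c' d') = quat
  (a * a' - ℤ→ℚ (+ 3) * b * b' - P * c * c' - ℤ→ℚ (+ 3) * P * d * d')
  (a * b' + b * a' + P * c * d' - P * d * c')
  (a * c' + c * a' - ℤ→ℚ (+ 3) * b * d' + ℤ→ℚ (+ 3) * d * b')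
  (a * d' + d * a' + b * c' - c * b')
  where P = ℤ→ℚ (+ p)

Nrd : ℕ → Quat → ℚ
Nrd p (quat a b c d) =
  a * a + ℤ→ℚ (+ 3) * b * b + P * c * c + ℤ→ℚ (+ 3) * P * d * d
  where P = ℤ→ℚ (+ p)

half third : ℚ
half = + 1 / 2
third = + 1 / 3

𝟙 𝕚 𝕛 : Quat
𝟙 = quat 1ℚ 0ℚ 0ℚ 0ℚ
𝕚 = quat 0ℚ 1ℚ 0ℚ 0ℚ
𝕛 = quat 0ℚ 0ℚ 1ℚ 0ℚ

ε ε̄ : Quat
ε = quat half half 0ℚ 0ℚ
ε̄ = quat half (- half) 0ℚ 0ℚ

b₃ b₄ : Quat
b₃ = quat 0ℚ third 0ℚ third
b₄ = quat 0ℚ 0ℚ half half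

InO : Quat → Set
InO μ = Σ ℤ λ c₁ → Σ ℤ λ c₂ → Σ ℤ λ c₃ → Σ ℤ λ c₄ →
  μ ≡ (((ℤ→ℚ c₁ · 𝟙) ⊕ (ℤ→ℚ c₂ · ε)) ⊕ (ℤ→ℚ c₃ · b₃)) ⊕ (ℤ→ℚ c₄ · b₄)

-- the rational number 1/ℓ (ℓ = 0 is never used: ℓ is prime below)
inv : ℕ → ℚ
inv zero = 0ℚ
inv (suc n) = + 1 / suc n

InℓinvO : ℕ → Quat → Set
InℓinvO ℓ μ = Σ Quat λ ω → InO ω × (μ ≡ inv ℓ · ω)

xyε : ℤ → ℤ → Quat
xyε x y = (ℤ→ℚ x · 𝟙) ⊕ (ℤ→ℚ y · ε)

{-# OPTIONS --safe #-}
module Submission where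

-- Clearing denominators, an element ℓ⁻¹(c₁ + c₂ ε + c₃ (i+k)/3 + c₄ (j+k)/2) of ℓ⁻¹𝒪 is
-- (A + B i + C j + D k)/(6ℓ) with A, B, C, D integral, and both hypotheses become integer equations.
-- For Nrd μ = 1 the (j,k)-part contributes 4p (c₃² + 3c₃c₄ + 3c₄²) to a total of 12ℓ² < 4p, so
-- c₃ = c₄ = 0 and μ = ℓ⁻¹(x + yε) with x² + xy + y² = ℓ². For s² = -p the cross terms force A = 0
-- (otherwise the real part of s² would be positive), then p ∣ c₃ - 3c₁ and the same size argument
-- makes it vanish, so s = ℓ⁻¹(x + yε)j with x² + xy + y² = ℓ².
-- Finally, if ℓ ∣ x then (x, y) is ℓ times one of the six units of ℤ[ε], which is excluded;
-- otherwise ℓ ≠ 3, and ℓ ≢ 2 (mod 3) because a prime q ≡ 2 (mod 3) dividing x² + xy + y² divides x: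
-- from x³ ≡ y³ and 3 ∣ q + 1, Fermat's little theorem gives x² ≡ y² (mod q).

module Fermat where

  open import Data.Nat as ℕ using (ℕ; zero; suc; _∸_; _!; z≤n; s≤s)
  import Data.Nat.Properties as ℕ
  import Data.Nat.Divisibility as ℕ
  open import Data.Nat.Primality using (Prime; ¬prime[1]; euclidsLemma)
  open import Data.Nat.Combinatorics using (_C_; nCk≡n!/k![n-k]!; k![n∸k]!∣n!; nCn≡1)
  open import Data.Nat.DivMod using (m*[n/m]≡n)
  open import Data.Integer as ℤ using (ℤ; +_; -[1+_]; 1ℤ; _+_; _*_; -_; _-_; _^_)
  import Data.Integer.Properties as ℤ
  open import Data.Integer.Divisibility.Signed
    using (divides; ∣ᵤ⇒∣; ∣m∣n⇒∣m+n; ∣m⇒∣m*n; ∣m⇒∣-m) renaming (_∣_ to _∣ₛ_)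
  open import Data.Integer.Tactic.RingSolver using (solve-∀)
  open import Data.Fin as Fin using (Fin; toℕ; fromℕ; inject₁)
  import Data.Fin.Properties as Fin
  open import Data.Sum using (inj₁; inj₂)
  open import Data.Empty using (⊥-elim)
  open import Relation.Nullary using (¬_)
  open import Relation.Binary.PropositionalEquality
  open import Function using (_∘_)
  open import Algebra.Properties.Semiring.Exp ℤ.+-*-semiring using () renaming (_^_ to _^′_)
  open import Algebra.Properties.Semiring.Mult ℤ.+-*-semiring using () renaming (_×_ to _×′_)
  open import Algebra.Properties.Semiring.Sum ℤ.+-*-semiring using (sum; sum-init-last)
  import Algebra.Properties.Semiring.Binomial ℤ.+-*-semiring as Binomial

  prime∣m!⇒p≤m : ∀ {p} → Prime p → ∀ m → p ℕ.∣ m ! → p ℕ.≤ m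
  prime∣m!⇒p≤m pp zero p∣1 with ℕ.∣1⇒≡1 p∣1
  ... | refl = ⊥-elim (¬prime[1] pp)
  prime∣m!⇒p≤m pp (suc m) p∣m! with euclidsLemma (suc m) (m !) pp p∣m!
  ... | inj₁ p∣1+m = ℕ.∣⇒≤ p∣1+m
  ... | inj₂ p∣m!  = ℕ.m≤n⇒m≤1+n (prime∣m!⇒p≤m pp m p∣m!)

  prime∣pCk : ∀ {p} → Prime p → ∀ k → 0 ℕ.< k → k ℕ.< p → p ℕ.∣ p C k
  prime∣pCk {p@(suc m)} pp k 0<k k<p = p∣pCk
    where
    k≤p : k ℕ.≤ p
    k≤p = ℕ.<⇒≤ k<p
    instance _ = ℕ.m*n≢0 (k !) ((p ∸ k) !) {{ℕ.>-nonZero (ℕ.1≤n! k)}} {{ℕ.>-nonZero (ℕ.1≤n! (p ∸ k))}}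
    p!≡ : (k ! ℕ.* (p ∸ k) !) ℕ.* (p C k) ≡ p !
    p!≡ = trans (cong ((k ! ℕ.* (p ∸ k) !) ℕ.*_) (nCk≡n!/k![n-k]! k≤p)) (m*[n/m]≡n (k![n∸k]!∣n! k≤p))
    p∣pCk : p ℕ.∣ p C k
    p∣pCk with euclidsLemma (k ! ℕ.* (p ∸ k) !) (p C k) pp (subst (p ℕ.∣_) (sym p!≡) (ℕ.m∣m*n (m !)))
    ... | inj₂ p∣pCk = p∣pCk
    ... | inj₁ p∣k![p-k]! with euclidsLemma (k !) ((p ∸ k) !) pp p∣k![p-k]!
    ...   | inj₁ p∣k!     = ⊥-elim (ℕ.<⇒≱ k<p (prime∣m!⇒p≤m pp k p∣k!))
    ...   | inj₂ p∣[p-k]! = ⊥-elim (ℕ.<⇒≱ (ℕ.∸-monoʳ-< 0<k k≤p) (prime∣m!⇒p≤m pp (p ∸ k) p∣[p-k]!))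

  ^′≡^ : ∀ a n → a ^′ n ≡ a ^ n
  ^′≡^ a zero    = refl
  ^′≡^ a (suc n) = cong (a *_) (^′≡^ a n)

  ×′≡* : ∀ n a → n ×′ a ≡ + n * a
  ×′≡* zero    a = refl
  ×′≡* (suc n) a = trans (cong (_+_ a) (×′≡* n a)) (collect a (+ n))
    where collect : ∀ a n → a + n * a ≡ (+ 1 + n) * a
          collect = solve-∀

  ∣ₛ-sum : ∀ {d} n (f : Fin n → ℤ) → (∀ i → d ∣ₛ f i) → d ∣ₛ sum f
  ∣ₛ-sum zero    f d∣f = divides (+ 0) refl
  ∣ₛ-sum (suc n) f d∣f = ∣m∣n⇒∣m+n (d∣f Fin.zero) (∣ₛ-sum n (f ∘ Fin.suc) (d∣f ∘ Fin.suc))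

  module _ (a b : ℤ) (m : ℕ) where
    open Binomial a b
    private
      p : ℕ
      p = suc m
      innerTerm : Fin m → ℤ
      innerTerm j = binomialTerm p (Fin.suc (inject₁ j))

    binomial-outerTerms : (a + b) ^ p ≡ b ^ p + (sum innerTerm + a ^ p)
    binomial-outerTerms = begin
      (a + b) ^ p                                       ≡⟨ sym (^′≡^ (a + b) p) ⟩
      (a + b) ^′ p                                      ≡⟨ theorem (ℤ.*-comm a b) p ⟩
      binomialTerm p Fin.zero + sum upperTerm           ≡⟨ cong (_+_ (binomialTerm p Fin.zero)) (sum-init-last upperTerm) ⟩
      (1ℤ * b ^′ p + + 0) + (sum innerTerm + upperTerm (fromℕ m))
                                                        ≡⟨ cong₂ (λ u v → (1ℤ * u + + 0) + (sum innerTerm + v)) (^′≡^ b p) lastTerm ⟩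
      (1ℤ * b ^ p + + 0) + (sum innerTerm + a ^ p)      ≡⟨ cong (_+ (sum innerTerm + a ^ p)) (tidy (b ^ p)) ⟩
      b ^ p + (sum innerTerm + a ^ p)                   ∎
      where
      open ≡-Reasoning
      upperTerm : Fin p → ℤ
      upperTerm i = binomialTerm p (Fin.suc i)
      tidy : ∀ x → 1ℤ * x + + 0 ≡ x
      tidy = solve-∀
      tidyʳ : ∀ x → x * 1ℤ + + 0 ≡ x
      tidyʳ = solve-∀
      lastTerm : upperTerm (fromℕ m) ≡ a ^ p
      lastTerm = begin
        (p C suc (toℕ (fromℕ m))) ×′ (a ^′ suc (toℕ (fromℕ m)) * b ^′ (m ∸ toℕ (fromℕ m)))
          ≡⟨ cong (λ k → (p C suc k) ×′ (a ^′ suc k * b ^′ (m ∸ k))) (Fin.toℕ-fromℕ m) ⟩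
        (p C p) ×′ (a ^′ p * b ^′ (m ∸ m))
          ≡⟨ cong₂ (λ c k → c ×′ (a ^′ p * b ^′ k)) (nCn≡1 p) (ℕ.n∸n≡0 m) ⟩
        a ^′ p * 1ℤ + + 0
          ≡⟨ cong (λ z → z * 1ℤ + + 0) (^′≡^ a p) ⟩
        a ^ p * 1ℤ + + 0
          ≡⟨ tidyʳ (a ^ p) ⟩
        a ^ p ∎

    prime∣innerTerms : Prime p → + p ∣ₛ sum innerTerm
    prime∣innerTerms pp = ∣ₛ-sum m innerTerm p∣innerTerm
      where
      p∣innerTerm : ∀ j → + p ∣ₛ innerTerm j
      p∣innerTerm j = subst (+ p ∣ₛ_) (sym (×′≡* (p C k) (binomial p (Fin.suc (inject₁ j)))))
        (∣m⇒∣m*n (binomial p (Fin.suc (inject₁ j))) (∣ᵤ⇒∣ {+ p} {+ (p C k)} (prime∣pCk pp k (s≤s z≤n) (s≤s j<m))))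
        where
        k : ℕ
        k = suc (toℕ (inject₁ j))
        j<m : toℕ (inject₁ j) ℕ.< m
        j<m = subst (ℕ._< m) (sym (Fin.toℕ-inject₁ j)) (Fin.toℕ<n j)

    freshmansDream : Prime p → + p ∣ₛ (a + b) ^ p - (a ^ p + b ^ p)
    freshmansDream pp = subst (+ p ∣ₛ_) (sym expand) (prime∣innerTerms pp)
      where
      expand : (a + b) ^ p - (a ^ p + b ^ p) ≡ sum innerTerm
      expand = trans (cong (_- (a ^ p + b ^ p)) binomial-outerTerms) (cancel (b ^ p) (sum innerTerm) (a ^ p))
        where cancel : ∀ x s y → x + (s + y) - (y + x) ≡ s
              cancel = solve-∀

  FermatHolds : ℕ → ℤ → Set
  FermatHolds p a = + p ∣ₛ a ^ p - a

  fermat-+ : ∀ {p} → Prime p → ∀ a b → FermatHolds p a → FermatHolds p b → FermatHolds p (a + b)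
  fermat-+ {suc m} pp a b pa pb = subst (+ suc m ∣ₛ_) (regroup ((a + b) ^ suc m) (a ^ suc m) (b ^ suc m) a b)
    (∣m∣n⇒∣m+n (∣m∣n⇒∣m+n (freshmansDream a b m pp) pa) pb)
    where regroup : ∀ s x y a b → ((s - (x + y)) + (x - a)) + (y - b) ≡ s - (a + b)
          regroup = solve-∀

  fermat-1 : ∀ {p} → FermatHolds p (+ 1)
  fermat-1 {p} = subst (λ z → + p ∣ₛ z - + 1) (sym (ℤ.^-zeroˡ p)) (divides (+ 0) refl)

  fermat-[-1] : ∀ {p} → Prime p → FermatHolds p -[1+ 0 ]
  fermat-[-1] {suc m} pp = subst (+ suc m ∣ₛ_) eq (∣m⇒∣-m (freshmansDream (+ 1) -[1+ 0 ] m pp))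
    where
    eq : - ((+ 1 + -[1+ 0 ]) ^ suc m - ((+ 1) ^ suc m + -[1+ 0 ] ^ suc m)) ≡ -[1+ 0 ] ^ suc m - -[1+ 0 ]
    eq = trans (cong (λ z → - (+ 0 - (z + -[1+ 0 ] ^ suc m))) (ℤ.^-zeroˡ (suc m))) (tidy (-[1+ 0 ] ^ suc m))
      where tidy : ∀ x → - (+ 0 - (+ 1 + x)) ≡ x - -[1+ 0 ]
            tidy = solve-∀

  fermat : ∀ {p} → Prime p → ∀ a → FermatHolds p a
  fermat {suc m} pp (+ zero)  = divides (+ 0) refl
  fermat pp (+ suc n)         = fermat-+ pp (+ 1) (+ n) fermat-1 (fermat pp (+ n))
  fermat pp -[1+ zero ]       = fermat-[-1] pp
  fermat {p} pp -[1+ suc n ]  = subst (FermatHolds p) (cong (λ k → -[1+ suc k ]) (ℕ.+-identityʳ n))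
    (fermat-+ pp -[1+ n ] -[1+ 0 ] (fermat pp -[1+ n ]) (fermat-[-1] pp))

module Squares where

  open import Data.Nat as ℕ using (ℕ; zero; suc; NonZero)
  import Data.Nat.Properties as ℕ
  import Data.Nat.Divisibility as ℕ
  open import Data.Integer as ℤ using (ℤ; +_; _+_; _*_)
  import Data.Integer.Properties as ℤ
  open import Data.Product using (_×_; _,_)
  open import Data.Sum using (inj₁; inj₂)
  open import Data.Empty using (⊥-elim)
  open import Relation.Binary.PropositionalEquality

  ∣_∣² : ℤ → ℕ
  ∣ z ∣² = ℤ.∣ z ∣ ℕ.* ℤ.∣ z ∣

  +∣z∣²≡z*z : ∀ z → + ∣ z ∣² ≡ z * z
  +∣z∣²≡z*z (+ n)      = ℤ.pos-* n n
  +∣z∣²≡z*z ℤ.-[1+ n ] = refl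

  ∣z∣²≡0⇒z≡0 : ∀ z → ∣ z ∣² ≡ 0 → z ≡ + 0
  ∣z∣²≡0⇒z≡0 z eq with ℕ.m*n≡0⇒m≡0∨n≡0 ℤ.∣ z ∣ eq
  ... | inj₁ ∣z∣≡0 = ℤ.∣i∣≡0⇒i≡0 ∣z∣≡0
  ... | inj₂ ∣z∣≡0 = ℤ.∣i∣≡0⇒i≡0 ∣z∣≡0

  +[∣x∣²+k∣y∣²]≡x²+ky² : ∀ k x y → + (∣ x ∣² ℕ.+ k ℕ.* ∣ y ∣²) ≡ x * x + + k * (y * y)
  +[∣x∣²+k∣y∣²]≡x²+ky² k x y = begin
    + (∣ x ∣² ℕ.+ k ℕ.* ∣ y ∣²)   ≡⟨ ℤ.pos-+ ∣ x ∣² (k ℕ.* ∣ y ∣²) ⟩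
    + ∣ x ∣² + + (k ℕ.* ∣ y ∣²)   ≡⟨ cong (_+_ (+ ∣ x ∣²)) (ℤ.pos-* k ∣ y ∣²) ⟩
    + ∣ x ∣² + + k * + ∣ y ∣²     ≡⟨ cong₂ (λ u v → u + + k * v) (+∣z∣²≡z*z x) (+∣z∣²≡z*z y) ⟩
    x * x + + k * (y * y)         ∎
    where open ≡-Reasoning

  ∣x∣²+k∣y∣²≡0⇒x≡0∧y≡0 : ∀ k .{{_ : NonZero k}} x y → ∣ x ∣² ℕ.+ k ℕ.* ∣ y ∣² ≡ 0 → x ≡ + 0 × y ≡ + 0
  ∣x∣²+k∣y∣²≡0⇒x≡0∧y≡0 k x y eq with ℕ.m*n≡0⇒m≡0∨n≡0 k (ℕ.m+n≡0⇒n≡0 ∣ x ∣² eq)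
  ... | inj₁ refl    = ⊥-elim (ℕ.≢-nonZero⁻¹ k refl)
  ... | inj₂ ∣y∣²≡0 = ∣z∣²≡0⇒z≡0 x (ℕ.m+n≡0⇒m≡0 ∣ x ∣² eq) , ∣z∣²≡0⇒z≡0 y ∣y∣²≡0

  m≡o+n*k⇒k≡0 : ∀ {m n d} o k → m ℕ.< n ℕ.* d → d ℕ.∣ k → m ≡ o ℕ.+ n ℕ.* k → k ≡ 0
  m≡o+n*k⇒k≡0 o zero    _     _   _   = refl
  m≡o+n*k⇒k≡0 {m} {n} {d} o k@(suc _) m<nd d∣k m≡o+nk = ⊥-elim (ℕ.<-irrefl refl (ℕ.<-≤-trans m<nd (begin
    n ℕ.* d       ≤⟨ ℕ.*-monoʳ-≤ n (ℕ.∣⇒≤ d∣k) ⟩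
    n ℕ.* k       ≤⟨ ℕ.m≤n+m (n ℕ.* k) o ⟩
    o ℕ.+ n ℕ.* k ≡⟨ m≡o+nk ⟨
    m             ∎)))
    where open ℕ.≤-Reasoning

module EisensteinNorm where

  open Fermat using (fermat)
  open Squares using (∣_∣²; +[∣x∣²+k∣y∣²]≡x²+ky²)
  open import Data.Nat as ℕ using (ℕ; zero; suc; z≤n; s≤s)
  import Data.Nat.Properties as ℕ
  import Data.Nat.Divisibility as ℕ
  open import Data.Nat.DivMod using (_%_; _/_; m≡m%n+[m/n]*n; m%n<n)
  open import Data.Nat.Primality using (Prime; euclidsLemma; prime⇒nonZero; prime⇒irreducible)
  open import Data.Integer as ℤ using (ℤ; +_; -[1+_]; _+_; _*_; -_; _-_; _^_)
  import Data.Integer.Properties as ℤ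
  open import Data.Integer.Divisibility using (_∣_)
  open import Data.Integer.Divisibility.Signed
    using (divides; ∣ᵤ⇒∣; ∣⇒∣ᵤ; ∣m∣n⇒∣m+n; ∣m∣n⇒∣m-n; ∣n⇒∣m*n; ∣m⇒∣-m) renaming (_∣_ to _∣ₛ_)
  open import Data.Integer.Tactic.RingSolver using (solve-∀)
  open import Data.Sum using (_⊎_; inj₁; inj₂; [_,_]′)
  open import Data.Product using (_×_; _,_)
  open import Data.Empty using (⊥-elim)
  open import Relation.Nullary using (¬_; yes; no)
  open import Relation.Binary.PropositionalEquality

  normForm : ℤ → ℤ → ℤ
  normForm x y = x * x + x * y + y * y

  prime∣*⇒∣⊎∣ : ∀ {q} → Prime q → ∀ a b → + q ∣ₛ a * b → + q ∣ₛ a ⊎ + q ∣ₛ b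
  prime∣*⇒∣⊎∣ {q} pq a b q∣ab with euclidsLemma ℤ.∣ a ∣ ℤ.∣ b ∣ pq (subst (q ℕ.∣_) (ℤ.abs-* a b) (∣⇒∣ᵤ q∣ab))
  ... | inj₁ q∣a = inj₁ (∣ᵤ⇒∣ q∣a)
  ... | inj₂ q∣b = inj₂ (∣ᵤ⇒∣ q∣b)

  prime∣²⇒∣ : ∀ {q} → Prime q → ∀ a → + q ∣ₛ a * a → + q ∣ₛ a
  prime∣²⇒∣ pq a q∣aa with prime∣*⇒∣⊎∣ pq a a q∣aa
  ... | inj₁ q∣a = q∣a
  ... | inj₂ q∣a = q∣a

  ∣-^ : ∀ {k a b} → k ∣ₛ a - b → ∀ n → k ∣ₛ a ^ n - b ^ n
  ∣-^ k∣a-b zero    = divides (+ 0) refl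
  ∣-^ {a = a} {b} k∣a-b (suc n) = subst (_ ∣ₛ_) (telescope a b (a ^ n) (b ^ n))
    (∣m∣n⇒∣m+n (∣n⇒∣m*n a (∣-^ k∣a-b n)) (∣n⇒∣m*n (b ^ n) k∣a-b))
    where telescope : ∀ a b x y → a * (x - y) + y * (a - b) ≡ a * x - b * y
          telescope = solve-∀

  ≡2[3]⇒∤3 : ∀ q → q % 3 ≡ 2 → ¬ q ℕ.∣ 3
  ≡2[3]⇒∤3 2 _ 2∣3 with ℕ.n∣m⇒m%n≡0 3 2 2∣3
  ... | ()
  ≡2[3]⇒∤3 (suc (suc (suc (suc k)))) _ q∣3 with ℕ.∣⇒≤ q∣3
  ... | s≤s (s≤s (s≤s ()))

  -- q ∣ x³ - y³ and q + 1 ≡ 0 (mod 3) give x^(q+1) ≡ y^(q+1), i.e. x² ≡ y² by Fermat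
  prime≡2[3]∣normForm⇒∣ : ∀ {q} → Prime q → q % 3 ≡ 2 → ∀ x y → + q ∣ₛ normForm x y → + q ∣ₛ x
  prime≡2[3]∣normForm⇒∣ {q} pq q≡2 x y q∣form =
    [ x-y-case , x+y-case ]′ (prime∣*⇒∣⊎∣ pq (x - y) (x + y) q∣x²-y²)
    where
    m : ℕ
    m = q / 3
    1+q≡3[1+m] : suc q ≡ 3 ℕ.* suc m
    1+q≡3[1+m] = trans (cong suc (trans (m≡m%n+[m/n]*n q 3) (cong (ℕ._+ m ℕ.* 3) q≡2)))
                       (trans (cong (3 ℕ.+_) (ℕ.*-comm m 3)) (sym (ℕ.*-suc 3 m)))
    cube-power : ∀ z → (z ^ 3) ^ suc m ≡ z * z ^ q
    cube-power z = trans (ℤ.^-*-assoc z 3 (suc m)) (cong (z ^_) (sym 1+q≡3[1+m]))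
    q∣x³-y³ : + q ∣ₛ x ^ 3 - y ^ 3
    q∣x³-y³ = subst (_ ∣ₛ_) (factor x y) (∣n⇒∣m*n (x - y) q∣form)
      where factor : ∀ x y → (x - y) * (x * x + x * y + y * y) ≡ x * (x * (x * + 1)) - y * (y * (y * + 1))
            factor = solve-∀
    q∣x^[q+1]-y^[q+1] : + q ∣ₛ x * x ^ q - y * y ^ q
    q∣x^[q+1]-y^[q+1] = subst (_ ∣ₛ_) (cong₂ _-_ (cube-power x) (cube-power y)) (∣-^ {a = x ^ 3} {y ^ 3} q∣x³-y³ (suc m))
    q∣z^[q+1]-z² : ∀ z → + q ∣ₛ z * z ^ q - z * z
    q∣z^[q+1]-z² z = subst (_ ∣ₛ_) (distrib z (z ^ q)) (∣n⇒∣m*n z (fermat pq z))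
      where distrib : ∀ z w → z * (w - z) ≡ z * w - z * z
            distrib = solve-∀
    q∣x²-y² : + q ∣ₛ (x - y) * (x + y)
    q∣x²-y² = subst (_ ∣ₛ_) (regroup (x * x ^ q) (y * y ^ q) x y)
      (∣m∣n⇒∣m+n (∣m∣n⇒∣m+n (∣m⇒∣-m (q∣z^[q+1]-z² x)) q∣x^[q+1]-y^[q+1]) (q∣z^[q+1]-z² y))
      where regroup : ∀ X Y x y → (- (X - x * x) + (X - Y)) + (Y - y * y) ≡ (x - y) * (x + y)
            regroup = solve-∀
    x-y-case : + q ∣ₛ x - y → + q ∣ₛ x
    x-y-case q∣x-y = [ (λ q∣3 → ⊥-elim (≡2[3]⇒∤3 q q≡2 (∣⇒∣ᵤ q∣3))) , prime∣²⇒∣ pq x ]′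
      (prime∣*⇒∣⊎∣ pq (+ 3) (x * x) (subst (_ ∣ₛ_) (identity x y) (∣m∣n⇒∣m+n q∣form (∣n⇒∣m*n (y + + 2 * x) q∣x-y))))
      where identity : ∀ x y → (x * x + x * y + y * y) + (y + + 2 * x) * (x - y) ≡ + 3 * (x * x)
            identity = solve-∀
    x+y-case : + q ∣ₛ x + y → + q ∣ₛ x
    x+y-case q∣x+y = prime∣²⇒∣ pq x (subst (_ ∣ₛ_) (identity x y) (∣m∣n⇒∣m-n q∣form (∣n⇒∣m*n y q∣x+y)))
      where identity : ∀ x y → (x * x + x * y + y * y) - y * (x + y) ≡ x * x
            identity = solve-∀

  normForm≡9⇒3∣ : Prime 3 → ∀ x y → normForm x y ≡ + 9 → + 3 ∣ₛ x
  normForm≡9⇒3∣ p3 x y form≡9 = prime∣²⇒∣ p3 x (divides (+ 1 + x * t - t * t) x²≡)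
    where
    3∣[x-y]² : + 3 ∣ₛ (x - y) * (x - y)
    3∣[x-y]² = divides (+ 3 - x * y)
      (trans (identity x y) (trans (cong (λ n → n - + 3 * (x * y)) form≡9) (factor x y)))
      where identity : ∀ x y → (x - y) * (x - y) ≡ (x * x + x * y + y * y) - + 3 * (x * y)
            identity = solve-∀
            factor : ∀ x y → + 9 - + 3 * (x * y) ≡ (+ 3 - x * y) * + 3
            factor = solve-∀
    3∣x-y : + 3 ∣ₛ x - y
    3∣x-y = prime∣²⇒∣ p3 (x - y) 3∣[x-y]²
    t : ℤ
    t = _∣ₛ_.quotient 3∣x-y
    y≡x-3t : y ≡ x - t * + 3
    y≡x-3t = trans (identity x y) (cong (_-_ x) (_∣ₛ_.equality 3∣x-y))
      where identity : ∀ x y → y ≡ x - (x - y)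
            identity = solve-∀
    x²≡ : x * x ≡ (+ 1 + x * t - t * t) * + 3
    x²≡ = ℤ.*-cancelˡ-≡ (+ 3) _ _ (begin
      + 3 * (x * x)                                     ≡⟨ expand x t ⟩
      normForm x (x - t * + 3) + + 9 * (x * t - t * t)   ≡⟨ cong (λ n → n + + 9 * (x * t - t * t)) (subst (λ y → normForm x y ≡ + 9) y≡x-3t form≡9) ⟩
      + 9 + + 9 * (x * t - t * t)                       ≡⟨ collect x t ⟩
      + 3 * ((+ 1 + x * t - t * t) * + 3)               ∎)
      where
      open ≡-Reasoning
      expand : ∀ x t → + 3 * (x * x) ≡ (x * x + x * (x - t * + 3) + (x - t * + 3) * (x - t * + 3)) + + 9 * (x * t - t * t)
      expand = solve-∀
      collect : ∀ x t → + 9 + + 9 * (x * t - t * t) ≡ + 3 * ((+ 1 + x * t - t * t) * + 3)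
      collect = solve-∀

  data EisensteinUnit : ℤ → ℤ → Set where
    +𝟙 : EisensteinUnit (+ 1) (+ 0)
    -𝟙 : EisensteinUnit -[1+ 0 ] (+ 0)
    +ε : EisensteinUnit (+ 0) (+ 1)
    -ε : EisensteinUnit (+ 0) -[1+ 0 ]
    +ε̄ : EisensteinUnit (+ 1) -[1+ 0 ]
    -ε̄ : EisensteinUnit -[1+ 0 ] (+ 1)

  a²+3b²≡4⇒b≤1 : ∀ a b → a ℕ.* a ℕ.+ 3 ℕ.* (b ℕ.* b) ≡ 4 → b ℕ.≤ 1
  a²+3b²≡4⇒b≤1 a zero          _ = z≤n
  a²+3b²≡4⇒b≤1 a (suc zero)    _ = s≤s z≤n
  a²+3b²≡4⇒b≤1 a (suc (suc b)) e with subst (12 ℕ.≤_) e (ℕ.≤-trans 12≤3b² (ℕ.m≤n+m _ (a ℕ.* a)))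
    where 12≤3b² = ℕ.*-monoʳ-≤ 3 (ℕ.*-mono-≤ {2} {suc (suc b)} {2} {suc (suc b)} (s≤s (s≤s z≤n)) (s≤s (s≤s z≤n)))
  ... | s≤s (s≤s (s≤s (s≤s ())))

  normForm≡1⇒∣y∣≤1 : ∀ x y → normForm x y ≡ + 1 → ℤ.∣ y ∣ ℕ.≤ 1
  normForm≡1⇒∣y∣≤1 x y form≡1 = a²+3b²≡4⇒b≤1 ℤ.∣ + 2 * x + y ∣ ℤ.∣ y ∣ (ℤ.+-injective (begin
    + (∣ + 2 * x + y ∣² ℕ.+ 3 ℕ.* ∣ y ∣²)          ≡⟨ +[∣x∣²+k∣y∣²]≡x²+ky² 3 (+ 2 * x + y) y ⟩
    (+ 2 * x + y) * (+ 2 * x + y) + + 3 * (y * y)  ≡⟨ complete-square x y ⟩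
    + 4 * normForm x y                             ≡⟨ cong (+ 4 *_) form≡1 ⟩
    + 4                                            ∎))
    where
    open ≡-Reasoning
    complete-square : ∀ x y → (+ 2 * x + y) * (+ 2 * x + y) + + 3 * (y * y) ≡ + 4 * (x * x + x * y + y * y)
    complete-square = solve-∀

  ∣z∣≤1 : ∀ z → ℤ.∣ z ∣ ℕ.≤ 1 → z ≡ + 0 ⊎ z ≡ + 1 ⊎ z ≡ -[1+ 0 ]
  ∣z∣≤1 (+ zero)          _ = inj₁ refl
  ∣z∣≤1 (+ suc zero)      _ = inj₂ (inj₁ refl)
  ∣z∣≤1 -[1+ zero ]       _ = inj₂ (inj₂ refl)
  ∣z∣≤1 (+ suc (suc n))   (s≤s ())
  ∣z∣≤1 -[1+ suc n ]      (s≤s ())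

  normForm≡1⇒unit : ∀ x y → normForm x y ≡ + 1 → EisensteinUnit x y
  normForm≡1⇒unit x y form≡1
    with ∣z∣≤1 x (normForm≡1⇒∣y∣≤1 y x (trans (symmetric x y) form≡1)) | ∣z∣≤1 y (normForm≡1⇒∣y∣≤1 x y form≡1)
    where symmetric : ∀ x y → y * y + y * x + x * x ≡ x * x + x * y + y * y
          symmetric = solve-∀
  ... | inj₁ refl        | inj₂ (inj₁ refl) = +ε
  ... | inj₁ refl        | inj₂ (inj₂ refl) = -ε
  ... | inj₂ (inj₁ refl) | inj₁ refl        = +𝟙
  ... | inj₂ (inj₁ refl) | inj₂ (inj₂ refl) = +ε̄
  ... | inj₂ (inj₂ refl) | inj₁ refl        = -𝟙
  ... | inj₂ (inj₂ refl) | inj₂ (inj₁ refl) = -ε̄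
  ... | inj₁ refl        | inj₁ refl        with () ← form≡1
  ... | inj₂ (inj₁ refl) | inj₂ (inj₁ refl) with () ← form≡1
  ... | inj₂ (inj₂ refl) | inj₂ (inj₂ refl) with () ← form≡1

  data UnitMultiple (c : ℤ) : ℤ → ℤ → Set where
    _·c : ∀ {x y} → EisensteinUnit x y → UnitMultiple c (x * c) (y * c)

  normForm≡ℓ²∧ℓ∣x⇒unitMultiple : ∀ {ℓ} → Prime ℓ → ∀ x y → normForm x y ≡ + (ℓ ℕ.* ℓ) → + ℓ ∣ₛ x → UnitMultiple (+ ℓ) x y
  normForm≡ℓ²∧ℓ∣x⇒unitMultiple {ℓ} pℓ .(x′ * + ℓ) y form≡ℓ² (divides x′ refl) = unitMultiple
    where
    instance _ = prime⇒nonZero pℓ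
    L : ℤ
    L = + ℓ
    form≡L² : normForm (x′ * L) y ≡ L * L
    form≡L² = trans form≡ℓ² (ℤ.pos-* ℓ ℓ)
    ℓ∣y : L ∣ₛ y
    ℓ∣y = prime∣²⇒∣ pℓ y (divides (L - x′ * x′ * L - x′ * y) (begin
      y * y                                   ≡⟨ isolate x′ y L ⟩
      normForm (x′ * L) y - x′ * L * (x′ * L + y) ≡⟨ cong (_- x′ * L * (x′ * L + y)) form≡L² ⟩
      L * L - x′ * L * (x′ * L + y)           ≡⟨ factor x′ y L ⟩
      (L - x′ * x′ * L - x′ * y) * L          ∎))
      where
      open ≡-Reasoning
      isolate : ∀ x′ y L → y * y ≡ (x′ * L * (x′ * L) + x′ * L * y + y * y) - x′ * L * (x′ * L + y)
      isolate = solve-∀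
      factor : ∀ x′ y L → L * L - x′ * L * (x′ * L + y) ≡ (L - x′ * x′ * L - x′ * y) * L
      factor = solve-∀
    unitMultiple : UnitMultiple L (x′ * L) y
    unitMultiple = subst (UnitMultiple L (x′ * L)) (sym y≡y′L) (normForm≡1⇒unit x′ y′ form′≡1 ·c)
      where
      open ≡-Reasoning
      y′ : ℤ
      y′ = _∣ₛ_.quotient ℓ∣y
      y≡y′L : y ≡ y′ * L
      y≡y′L = _∣ₛ_.equality ℓ∣y
      scale : ∀ x y L → L * L * (x * x + x * y + y * y) ≡ (x * L) * (x * L) + (x * L) * (y * L) + (y * L) * (y * L)
      scale = solve-∀
      form′≡1 : normForm x′ y′ ≡ + 1
      form′≡1 = ℤ.*-cancelˡ-≡ (L * L) _ _ {{ℤ.i*j≢0 L L}} (begin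
        L * L * normForm x′ y′       ≡⟨ scale x′ y′ L ⟩
        normForm (x′ * L) (y′ * L)   ≡⟨ cong (normForm (x′ * L)) y≡y′L ⟨
        normForm (x′ * L) y          ≡⟨ form≡L² ⟩
        L * L                        ≡⟨ ℤ.*-identityʳ (L * L) ⟨
        L * L * + 1                  ∎)

  normForm≡ℓ²⇒primitive⊎unitMultiple : ∀ {ℓ} → Prime ℓ → ∀ x y → normForm x y ≡ + (ℓ ℕ.* ℓ) →
    (ℓ % 3 ≡ 1 × ¬ (+ ℓ ∣ x)) ⊎ UnitMultiple (+ ℓ) x y
  normForm≡ℓ²⇒primitive⊎unitMultiple {ℓ} pℓ x y form≡ℓ² with ℓ ℕ.∣? ℤ.∣ x ∣
  ... | yes ℓ∣x = inj₂ (normForm≡ℓ²∧ℓ∣x⇒unitMultiple pℓ x y form≡ℓ² (∣ᵤ⇒∣ ℓ∣x))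
  ... | no  ℓ∤x = inj₁ (ℓ≡1[3] , ℓ∤x)
    where
    instance _ = prime⇒nonZero pℓ
    ℓ≡1[3] : ℓ % 3 ≡ 1
    ℓ≡1[3] with ℓ % 3 in eq | m%n<n ℓ 3
    ... | 0 | _ with prime⇒irreducible pℓ (ℕ.m%n≡0⇒n∣m ℓ 3 eq)
    ...   | inj₁ ()
    ...   | inj₂ refl = ⊥-elim (ℓ∤x (∣⇒∣ᵤ (normForm≡9⇒3∣ pℓ x y form≡ℓ²)))
    ℓ≡1[3] | 1 | _ = refl
    ℓ≡1[3] | 2 | _ = ⊥-elim (ℓ∤x (∣⇒∣ᵤ (prime≡2[3]∣normForm⇒∣ pℓ eq x y (divides (+ ℓ) (trans form≡ℓ² (ℤ.pos-* ℓ ℓ))))))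
    ℓ≡1[3] | suc (suc (suc _)) | s≤s (s≤s (s≤s ()))

module Fractions where

  open import Data.Nat using (suc)
  open import Data.Integer as ℤ using (ℤ; +_; _+_; _*_; -_; _-_; NonZero)
  import Data.Integer.Properties as ℤ
  open import Data.Integer.Tactic.RingSolver using (solve-∀)
  open import Data.Rational as ℚ using (ℚ; ↥_; ↧_; 0ℚ; 1ℚ)
  import Data.Rational.Properties as ℚ
  open import Relation.Binary.PropositionalEquality

  record Fraction (q : ℚ) (n d : ℤ) : Set where
    constructor fraction
    field
      cross       : ↥ q * d ≡ n * ↧ q
      denominator≢0 : NonZero d
  open Fraction public

  cross-trans : ∀ {a b c d e f} → NonZero d → a * d ≡ c * b → c * f ≡ e * d → a * f ≡ e * b
  cross-trans {a} {b} {c} {d} {e} {f} d≢0 ad≡cb cf≡ed = ℤ.*-cancelˡ-≡ d _ _ {{d≢0}} (begin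
    d * (a * f)   ≡⟨ swap d a f ⟩
    (a * d) * f   ≡⟨ cong (_* f) ad≡cb ⟩
    (c * b) * f   ≡⟨ swap′ c b f ⟩
    (c * f) * b   ≡⟨ cong (_* b) cf≡ed ⟩
    (e * d) * b   ≡⟨ swap″ e d b ⟩
    d * (e * b)   ∎)
    where
    open ≡-Reasoning
    swap : ∀ d a f → d * (a * f) ≡ (a * d) * f
    swap = solve-∀
    swap′ : ∀ c b f → (c * b) * f ≡ (c * f) * b
    swap′ = solve-∀
    swap″ : ∀ e d b → (e * d) * b ≡ d * (e * b)
    swap″ = solve-∀

  fraction-rescale : ∀ {q n d n′ d′} → Fraction q n d → n * d′ ≡ n′ * d → NonZero d′ → Fraction q n′ d′
  fraction-rescale {q} {n} {d} {n′} {d′} (fraction q≡n/d d≢0) n/d≡n′/d′ =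
    fraction (cross-trans {↥ q} {↧ q} {n} {d} {n′} {d′} d≢0 q≡n/d n/d≡n′/d′)

  fraction-cross : ∀ {q n d n′ d′} → Fraction q n d → Fraction q n′ d′ → n * d′ ≡ n′ * d
  fraction-cross {q} {n} {d} {n′} {d′} (fraction q≡n/d _) (fraction q≡n′/d′ _) =
    cross-trans {n} {d} {↥ q} {↧ q} {n′} {d′} _ (sym q≡n/d) q≡n′/d′

  fraction-injective : ∀ {q q′ n d n′ d′} → Fraction q n d → Fraction q′ n′ d′ → n * d′ ≡ n′ * d → q ≡ q′
  fraction-injective {q} {q′} {n} {d} {n′} {d′} (fraction q≡n/d d≢0) (fraction q′≡n′/d′ d′≢0) n/d≡n′/d′ =
    ℚ.≃⇒≡ (ℚ.*≡* (cross-trans {↥ q} {↧ q} {n′} {d′} {↥ q′} {↧ q′} d′≢0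
      (cross-trans {↥ q} {↧ q} {n} {d} {n′} {d′} d≢0 q≡n/d n/d≡n′/d′) (sym q′≡n′/d′)))

  fraction-of-multiple : ∀ {q g X Y n d} → ↥ q * g ≡ X → ↧ q * g ≡ Y → NonZero Y → X * d ≡ n * Y → NonZero d →
    Fraction q n d
  fraction-of-multiple {q} {g} {X} {Y} {n} {d} ↥q*g≡X ↧q*g≡Y Y≢0 X/Y≡n/d =
    fraction (cross-trans {↥ q} {↧ q} {X} {Y} {n} {d} Y≢0 q≡X/Y X/Y≡n/d)
    where
    q≡X/Y : ↥ q * Y ≡ X * ↧ q
    q≡X/Y = begin
      ↥ q * Y         ≡⟨ cong (↥ q *_) ↧q*g≡Y ⟨
      ↥ q * (↧ q * g) ≡⟨ swap (↥ q) (↧ q) g ⟩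
      (↥ q * g) * ↧ q ≡⟨ cong (_* ↧ q) ↥q*g≡X ⟩
      X * ↧ q         ∎
      where
      open ≡-Reasoning
      swap : ∀ u v g → u * (v * g) ≡ (u * g) * v
      swap = solve-∀

  fraction-/ : ∀ i n → Fraction (i ℚ./ suc n) i (+ suc n)
  fraction-/ i n = fraction-of-multiple (ℚ.↥-/ i (suc n)) (ℚ.↧-/ i (suc n)) _ refl _

  fraction-+ : ∀ {q r n₁ d₁ n₂ d₂} → Fraction q n₁ d₁ → Fraction r n₂ d₂ →
    Fraction (q ℚ.+ r) (n₁ * d₂ + n₂ * d₁) (d₁ * d₂)
  fraction-+ {q} {r} {n₁} {d₁} {n₂} {d₂} (fraction q≡n₁/d₁ d₁≢0) (fraction r≡n₂/d₂ d₂≢0) =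
    fraction-of-multiple (ℚ.↥-+ q r) (ℚ.↧-+ q r) (ℤ.i*j≢0 (↧ q) (↧ r)) (begin
      (↥ q * ↧ r + ↥ r * ↧ q) * (d₁ * d₂)                 ≡⟨ expand (↥ q) (↧ q) (↥ r) (↧ r) d₁ d₂ ⟩
      (↥ q * d₁) * (↧ r * d₂) + (↥ r * d₂) * (↧ q * d₁)   ≡⟨ cong₂ (λ u v → u * (↧ r * d₂) + v * (↧ q * d₁)) q≡n₁/d₁ r≡n₂/d₂ ⟩
      (n₁ * ↧ q) * (↧ r * d₂) + (n₂ * ↧ r) * (↧ q * d₁)   ≡⟨ collect (↧ q) (↧ r) d₁ d₂ n₁ n₂ ⟩
      (n₁ * d₂ + n₂ * d₁) * (↧ q * ↧ r)                   ∎)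
      (ℤ.i*j≢0 d₁ d₂ {{d₁≢0}} {{d₂≢0}})
    where
    open ≡-Reasoning
    expand : ∀ a b c e d₁ d₂ → (a * e + c * b) * (d₁ * d₂) ≡ (a * d₁) * (e * d₂) + (c * d₂) * (b * d₁)
    expand = solve-∀
    collect : ∀ b e d₁ d₂ n₁ n₂ → (n₁ * b) * (e * d₂) + (n₂ * e) * (b * d₁) ≡ (n₁ * d₂ + n₂ * d₁) * (b * e)
    collect = solve-∀

  fraction-* : ∀ {q r n₁ d₁ n₂ d₂} → Fraction q n₁ d₁ → Fraction r n₂ d₂ → Fraction (q ℚ.* r) (n₁ * n₂) (d₁ * d₂)
  fraction-* {q} {r} {n₁} {d₁} {n₂} {d₂} (fraction q≡n₁/d₁ d₁≢0) (fraction r≡n₂/d₂ d₂≢0) =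
    fraction-of-multiple (ℚ.↥-* q r) (ℚ.↧-* q r) (ℤ.i*j≢0 (↧ q) (↧ r)) (begin
      (↥ q * ↥ r) * (d₁ * d₂)   ≡⟨ interchange (↥ q) (↥ r) d₁ d₂ ⟩
      (↥ q * d₁) * (↥ r * d₂)   ≡⟨ cong₂ _*_ q≡n₁/d₁ r≡n₂/d₂ ⟩
      (n₁ * ↧ q) * (n₂ * ↧ r)   ≡⟨ interchange n₁ n₂ (↧ q) (↧ r) ⟨
      (n₁ * n₂) * (↧ q * ↧ r)   ∎)
      (ℤ.i*j≢0 d₁ d₂ {{d₁≢0}} {{d₂≢0}})
    where
    open ≡-Reasoning
    interchange : ∀ a c d₁ d₂ → (a * c) * (d₁ * d₂) ≡ (a * d₁) * (c * d₂)
    interchange = solve-∀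

  fraction-neg : ∀ {q n d} → Fraction q n d → Fraction (ℚ.- q) (- n) d
  fraction-neg {q} {n} {d} (fraction q≡n/d d≢0) = fraction (begin
    ↥ (ℚ.- q) * d     ≡⟨ cong (_* d) (ℚ.↥-neg q) ⟩
    - ↥ q * d         ≡⟨ ℤ.neg-distribˡ-* (↥ q) d ⟨
    - (↥ q * d)       ≡⟨ cong -_ q≡n/d ⟩
    - (n * ↧ q)       ≡⟨ ℤ.neg-distribˡ-* n (↧ q) ⟩
    - n * ↧ q         ≡⟨ cong (- n *_) (ℚ.↧-neg q) ⟨
    - n * ↧ (ℚ.- q)   ∎) d≢0
    where open ≡-Reasoning

  fraction-sub : ∀ {q r n₁ d₁ n₂ d₂} → Fraction q n₁ d₁ → Fraction r n₂ d₂ →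
    Fraction (q ℚ.- r) (n₁ * d₂ + - n₂ * d₁) (d₁ * d₂)
  fraction-sub q≡n₁/d₁ r≡n₂/d₂ = fraction-+ q≡n₁/d₁ (fraction-neg r≡n₂/d₂)

  fraction-ℤ : ∀ z → Fraction (z ℚ./ 1) z (+ 1)
  fraction-ℤ z = fraction-/ z 0

  fraction-0 : ∀ n → Fraction 0ℚ (+ 0) (+ suc n)
  fraction-0 n = fraction refl _

  fraction-1 : Fraction 1ℚ (+ 1) (+ 1)
  fraction-1 = fraction refl _

module QuaternionCoordinates where

  open import Defs
  open Fractions
  open import Data.Nat using (ℕ)
  open import Data.Integer as ℤ using (ℤ; +_; _+_; _*_; -_; _-_; NonZero)
  import Data.Integer.Properties as ℤ
  open import Data.Integer.Tactic.RingSolver using (solve)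
  open import Data.List using (_∷_; [])
  open import Data.Product using (_×_; _,_)
  open import Relation.Binary.PropositionalEquality

  record Coordinates (u : Quat) (a b c d D : ℤ) : Set where
    constructor coordinates
    field
      re≡ : Fraction (re u) a D
      ci≡ : Fraction (ci u) b D
      cj≡ : Fraction (cj u) c D
      ck≡ : Fraction (ck u) d D
  open Coordinates public

  quat-≡ : ∀ {u v} → re u ≡ re v → ci u ≡ ci v → cj u ≡ cj v → ck u ≡ ck v → u ≡ v
  quat-≡ {quat _ _ _ _} {quat _ _ _ _} refl refl refl refl = refl

  coordinates-injective : ∀ {u v a b c d D a′ b′ c′ d′ D′} → Coordinates u a b c d D → Coordinates v a′ b′ c′ d′ D′ →
    a * D′ ≡ a′ * D → b * D′ ≡ b′ * D → c * D′ ≡ c′ * D → d * D′ ≡ d′ * D → u ≡ v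
  coordinates-injective (coordinates a b c d) (coordinates a′ b′ c′ d′) ea eb ec ed =
    quat-≡ (fraction-injective a a′ ea) (fraction-injective b b′ eb) (fraction-injective c c′ ec) (fraction-injective d d′ ed)

  coordinates-rescale : ∀ {u a b c d D a′ b′ c′ d′ D′} → Coordinates u a b c d D →
    a * D′ ≡ a′ * D → b * D′ ≡ b′ * D → c * D′ ≡ c′ * D → d * D′ ≡ d′ * D → NonZero D′ → Coordinates u a′ b′ c′ d′ D′
  coordinates-rescale (coordinates a b c d) ea eb ec ed D′≢0 = coordinates
    (fraction-rescale a ea D′≢0) (fraction-rescale b eb D′≢0) (fraction-rescale c ec D′≢0) (fraction-rescale d ed D′≢0)

  coordinates-⊕ : ∀ {u v a b c d D a′ b′ c′ d′ D′} → Coordinates u a b c d D → Coordinates v a′ b′ c′ d′ D′ →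
    Coordinates (u ⊕ v) (a * D′ + a′ * D) (b * D′ + b′ * D) (c * D′ + c′ * D) (d * D′ + d′ * D) (D * D′)
  coordinates-⊕ {quat _ _ _ _} {quat _ _ _ _} (coordinates a b c d) (coordinates a′ b′ c′ d′) =
    coordinates (fraction-+ a a′) (fraction-+ b b′) (fraction-+ c c′) (fraction-+ d d′)

  coordinates-· : ∀ {r m e u a b c d D} → Fraction r m e → Coordinates u a b c d D →
    Coordinates (r · u) (m * a) (m * b) (m * c) (m * d) (e * D)
  coordinates-· {u = quat _ _ _ _} r (coordinates a b c d) =
    coordinates (fraction-* r a) (fraction-* r b) (fraction-* r c) (fraction-* r d)

  coordinates-neg : ∀ {u a b c d D} → Coordinates u a b c d D → Coordinates (neg u) (- a) (- b) (- c) (- d) D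
  coordinates-neg {quat _ _ _ _} (coordinates a b c d) =
    coordinates (fraction-neg a) (fraction-neg b) (fraction-neg c) (fraction-neg d)

  coordinates-cross : ∀ {u a b c d D a′ b′ c′ d′ D′} → Coordinates u a b c d D → Coordinates u a′ b′ c′ d′ D′ →
    a * D′ ≡ a′ * D × b * D′ ≡ b′ * D × c * D′ ≡ c′ * D × d * D′ ≡ d′ * D
  coordinates-cross (coordinates a b c d) (coordinates a′ b′ c′ d′) =
    fraction-cross a a′ , fraction-cross b b′ , fraction-cross c c′ , fraction-cross d d′

  coordinates-sc : ∀ {q n} → Fraction q n (+ 1) → Coordinates (sc q) n (+ 0) (+ 0) (+ 0) (+ 1)
  coordinates-sc q = coordinates q (fraction-0 0) (fraction-0 0) (fraction-0 0)

  coordinates-𝟙 : Coordinates 𝟙 (+ 1) (+ 0) (+ 0) (+ 0) (+ 1)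
  coordinates-𝟙 = coordinates-sc fraction-1

  coordinates-𝕛 : Coordinates 𝕛 (+ 0) (+ 0) (+ 1) (+ 0) (+ 1)
  coordinates-𝕛 = coordinates (fraction-0 0) (fraction-0 0) fraction-1 (fraction-0 0)

  coordinates-ε : Coordinates ε (+ 1) (+ 1) (+ 0) (+ 0) (+ 2)
  coordinates-ε = coordinates (fraction-/ (+ 1) 1) (fraction-/ (+ 1) 1) (fraction-0 1) (fraction-0 1)

  coordinates-ε̄ : Coordinates ε̄ (+ 1) (- + 1) (+ 0) (+ 0) (+ 2)
  coordinates-ε̄ = coordinates (fraction-/ (+ 1) 1) (fraction-neg (fraction-/ (+ 1) 1)) (fraction-0 1) (fraction-0 1)

  coordinates-b₃ : Coordinates b₃ (+ 0) (+ 1) (+ 0) (+ 1) (+ 3)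
  coordinates-b₃ = coordinates (fraction-0 2) (fraction-/ (+ 1) 2) (fraction-0 2) (fraction-/ (+ 1) 2)

  coordinates-b₄ : Coordinates b₄ (+ 0) (+ 0) (+ 1) (+ 1) (+ 2)
  coordinates-b₄ = coordinates (fraction-0 1) (fraction-0 1) (fraction-/ (+ 1) 1) (fraction-/ (+ 1) 1)

  coordinates-xyε : ∀ x y → Coordinates (xyε x y) (+ 2 * x + y) y (+ 0) (+ 0) (+ 2)
  coordinates-xyε x y = coordinates-rescale
    (coordinates-⊕ (coordinates-· (fraction-ℤ x) coordinates-𝟙) (coordinates-· (fraction-ℤ y) coordinates-ε))
    (solve (x ∷ y ∷ [])) (solve (x ∷ y ∷ [])) (solve (x ∷ y ∷ [])) (solve (x ∷ y ∷ [])) _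

  -- P is a variable rather than + p so that the ring solver treats it as an atom.
  module _ (p : ℕ) {P : ℤ} (fP : Fraction (ℤ→ℚ (+ p)) P (+ 1)) where

    coordinates-mul : ∀ {u v a b c d D a′ b′ c′ d′ D′} → Coordinates u a b c d D → Coordinates v a′ b′ c′ d′ D′ →
      Coordinates (mul p u v)
        (a * a′ - + 3 * b * b′ - P * c * c′ - + 3 * P * d * d′)
        (a * b′ + b * a′ + P * c * d′ - P * d * c′)
        (a * c′ + c * a′ - + 3 * b * d′ + + 3 * d * b′)
        (a * d′ + d * a′ + b * c′ - c * b′)
        (D * D′)
    coordinates-mul {quat _ _ _ _} {quat _ _ _ _} {a} {b} {c} {d} {D} {a′} {b′} {c′} {d′} {D′}
      (coordinates fa fb fc fd) (coordinates fa′ fb′ fc′ fd′) = coordinates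
      (fraction-rescale (fraction-sub (fraction-sub (fraction-sub (fraction-* fa fa′) (fraction-* (fraction-* f3 fb) fb′))
          (fraction-* (fraction-* fP fc) fc′)) (fraction-* (fraction-* (fraction-* f3 fP) fd) fd′))
        (solve (a ∷ b ∷ c ∷ d ∷ D ∷ a′ ∷ b′ ∷ c′ ∷ d′ ∷ D′ ∷ P ∷ [])) D*D′≢0)
      (fraction-rescale (fraction-sub (fraction-+ (fraction-+ (fraction-* fa fb′) (fraction-* fb fa′))
          (fraction-* (fraction-* fP fc) fd′)) (fraction-* (fraction-* fP fd) fc′))
        (solve (a ∷ b ∷ c ∷ d ∷ D ∷ a′ ∷ b′ ∷ c′ ∷ d′ ∷ D′ ∷ P ∷ [])) D*D′≢0)
      (fraction-rescale (fraction-+ (fraction-sub (fraction-+ (fraction-* fa fc′) (fraction-* fc fa′))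
          (fraction-* (fraction-* f3 fb) fd′)) (fraction-* (fraction-* f3 fd) fb′))
        (solve (a ∷ b ∷ c ∷ d ∷ D ∷ a′ ∷ b′ ∷ c′ ∷ d′ ∷ D′ ∷ P ∷ [])) D*D′≢0)
      (fraction-rescale (fraction-sub (fraction-+ (fraction-+ (fraction-* fa fd′) (fraction-* fd fa′))
          (fraction-* fb fc′)) (fraction-* fc fb′))
        (solve (a ∷ b ∷ c ∷ d ∷ D ∷ a′ ∷ b′ ∷ c′ ∷ d′ ∷ D′ ∷ P ∷ [])) D*D′≢0)
      where
      f3 : Fraction (ℤ→ℚ (+ 3)) (+ 3) (+ 1)
      f3 = fraction-ℤ (+ 3)
      D*D′≢0 : NonZero (D * D′)
      D*D′≢0 = ℤ.i*j≢0 D D′ {{denominator≢0 fa}} {{denominator≢0 fa′}}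

    fraction-Nrd : ∀ {u a b c d D} → Coordinates u a b c d D →
      Fraction (Nrd p u) (a * a + + 3 * b * b + P * c * c + + 3 * P * d * d) (D * D)
    fraction-Nrd {quat _ _ _ _} {a} {b} {c} {d} {D} (coordinates fa fb fc fd) = fraction-rescale
      (fraction-+ (fraction-+ (fraction-+ (fraction-* fa fa) (fraction-* (fraction-* f3 fb) fb))
        (fraction-* (fraction-* fP fc) fc)) (fraction-* (fraction-* (fraction-* f3 fP) fd) fd))
      (solve (a ∷ b ∷ c ∷ d ∷ D ∷ P ∷ [])) (ℤ.i*j≢0 D D {{denominator≢0 fa}} {{denominator≢0 fa}})
      where
      f3 : Fraction (ℤ→ℚ (+ 3)) (+ 3) (+ 1)
      f3 = fraction-ℤ (+ 3)

module OrderEquations where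

  open Squares
  open EisensteinNorm using (normForm; prime∣²⇒∣)
  open import Data.Nat as ℕ using (ℕ)
  import Data.Nat.Properties as ℕ
  import Data.Nat.Divisibility as ℕ
  open import Data.Nat.Primality using (Prime; prime⇒nonZero)
  open import Data.Integer as ℤ using (ℤ; +_; _+_; _*_; -_; _-_)
  import Data.Integer.Properties as ℤ
  open import Data.Integer.Divisibility.Signed using (divides; ∣⇒∣ᵤ) renaming (_∣_ to _∣ₛ_)
  open import Data.Integer.Tactic.RingSolver using (solve-∀)
  open import Data.Product using (_×_; _,_; proj₁; proj₂)
  open import Data.Sum using (inj₁; inj₂)
  open import Data.Empty using (⊥-elim)
  open import Relation.Nullary using (yes; no)
  open import Relation.Binary.PropositionalEquality

  module NormEquations (P L c₁ c₂ c₃ c₄ : ℤ) where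
    -- 6 (c₁ + c₂ (1+i)/2 + c₃ (i+k)/3 + c₄ (j+k)/2) = A + B i + C j + D k
    A B C D : ℤ
    A = + 6 * c₁ + + 3 * c₂
    B = + 3 * c₂ + + 2 * c₃
    C = + 3 * c₄
    D = + 2 * c₃ + + 3 * c₄

    NormOne : Set
    NormOne = A * A + + 3 * B * B + P * C * C + + 3 * P * D * D ≡ (+ 6 * L) * (+ 6 * L)

    SquareMinusP : Set
    SquareMinusP = A * A - + 3 * B * B - P * C * C - + 3 * P * D * D ≡ - (P * ((+ 6 * L) * (+ 6 * L)))
                 × A * B ≡ + 0 × A * C ≡ + 0 × A * D ≡ + 0

    T Q : ℤ
    T = c₃ - + 3 * c₁
    Q = c₃ * c₃ + + 3 * c₃ * c₄ + + 3 * c₄ * c₄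

  module IntegerSolutions (p ℓ : ℕ) (c₁ c₂ c₃ c₄ : ℤ) where
    P L : ℤ
    P = + p
    L = + ℓ
    open NormEquations P L c₁ c₂ c₃ c₄

    -- the (j, k)-part of the norm is p (D² + 3 c₄²) = 4 p (c₃² + 3 c₃ c₄ + 3 c₄²)
    NormOne⇒ : 3 ℕ.* (ℓ ℕ.* ℓ) ℕ.< p → NormOne → c₃ ≡ + 0 × c₄ ≡ + 0 × normForm c₁ c₂ ≡ + (ℓ ℕ.* ℓ)
    NormOne⇒ 3ℓ²<p norm≡ = c₃≡0 , c₄≡0 , form≡ℓ²
      where
      Z : ℤ
      Z = + 2 * c₁ + c₂
      split : + 12 * (L * L) ≡ (B * B + + 3 * (Z * Z)) + P * (D * D + + 3 * (c₄ * c₄))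
      split = ℤ.*-cancelˡ-≡ (+ 3) _ _ (trans (lhs L) (trans (sym norm≡) (rhs c₁ c₂ c₃ c₄ P)))
        where
        lhs : ∀ L → + 3 * (+ 12 * (L * L)) ≡ (+ 6 * L) * (+ 6 * L)
        lhs = solve-∀
        rhs : ∀ c₁ c₂ c₃ c₄ P →
          (+ 6 * c₁ + + 3 * c₂) * (+ 6 * c₁ + + 3 * c₂) + + 3 * (+ 3 * c₂ + + 2 * c₃) * (+ 3 * c₂ + + 2 * c₃)
            + P * (+ 3 * c₄) * (+ 3 * c₄) + + 3 * P * (+ 2 * c₃ + + 3 * c₄) * (+ 2 * c₃ + + 3 * c₄)
          ≡ + 3 * (((+ 3 * c₂ + + 2 * c₃) * (+ 3 * c₂ + + 2 * c₃) + + 3 * ((+ 2 * c₁ + c₂) * (+ 2 * c₁ + c₂)))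
                   + P * ((+ 2 * c₃ + + 3 * c₄) * (+ 2 * c₃ + + 3 * c₄) + + 3 * (c₄ * c₄)))
        rhs = solve-∀
      N : ℕ
      N = ∣ D ∣² ℕ.+ 3 ℕ.* ∣ c₄ ∣²
      4∣N : 4 ℕ.∣ N
      4∣N = ∣⇒∣ᵤ (divides Q (trans (+[∣x∣²+k∣y∣²]≡x²+ky² 3 D c₄) (quadruple c₃ c₄)))
        where quadruple : ∀ c₃ c₄ → (+ 2 * c₃ + + 3 * c₄) * (+ 2 * c₃ + + 3 * c₄) + + 3 * (c₄ * c₄)
                                    ≡ (c₃ * c₃ + + 3 * c₃ * c₄ + + 3 * c₄ * c₄) * + 4
              quadruple = solve-∀
      splitℕ : 12 ℕ.* (ℓ ℕ.* ℓ) ≡ (∣ B ∣² ℕ.+ 3 ℕ.* ∣ Z ∣²) ℕ.+ p ℕ.* N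
      splitℕ = ℤ.+-injective (begin
        + (12 ℕ.* (ℓ ℕ.* ℓ))                               ≡⟨ trans (ℤ.pos-* 12 (ℓ ℕ.* ℓ)) (cong (+ 12 *_) (ℤ.pos-* ℓ ℓ)) ⟩
        + 12 * (L * L)                                     ≡⟨ split ⟩
        (B * B + + 3 * (Z * Z)) + P * (D * D + + 3 * (c₄ * c₄))
          ≡⟨ cong₂ (λ u v → u + P * v) (+[∣x∣²+k∣y∣²]≡x²+ky² 3 B Z) (+[∣x∣²+k∣y∣²]≡x²+ky² 3 D c₄) ⟨
        + (∣ B ∣² ℕ.+ 3 ℕ.* ∣ Z ∣²) + P * + N
          ≡⟨ trans (ℤ.pos-+ _ (p ℕ.* N)) (cong (_+_ (+ (∣ B ∣² ℕ.+ 3 ℕ.* ∣ Z ∣²))) (ℤ.pos-* p N)) ⟨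
        + ((∣ B ∣² ℕ.+ 3 ℕ.* ∣ Z ∣²) ℕ.+ p ℕ.* N)            ∎)
        where open ≡-Reasoning
      12ℓ²<4p : 12 ℕ.* (ℓ ℕ.* ℓ) ℕ.< p ℕ.* 4
      12ℓ²<4p = subst₂ ℕ._<_ (sym (ℕ.*-assoc 4 3 (ℓ ℕ.* ℓ))) (ℕ.*-comm 4 p) (ℕ.*-monoʳ-< 4 3ℓ²<p)
      D≡0∧c₄≡0 : D ≡ + 0 × c₄ ≡ + 0
      D≡0∧c₄≡0 = ∣x∣²+k∣y∣²≡0⇒x≡0∧y≡0 3 D c₄ (m≡o+n*k⇒k≡0 {n = p} (∣ B ∣² ℕ.+ 3 ℕ.* ∣ Z ∣²) N 12ℓ²<4p 4∣N splitℕ)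
      c₄≡0 : c₄ ≡ + 0
      c₄≡0 = D≡0∧c₄≡0 .proj₂
      c₃≡0 : c₃ ≡ + 0
      c₃≡0 = ℤ.*-cancelˡ-≡ (+ 2) _ _ (trans (isolate c₃ c₄) (cong₂ (λ u v → u - + 3 * v) (D≡0∧c₄≡0 .proj₁) c₄≡0))
        where isolate : ∀ c₃ c₄ → + 2 * c₃ ≡ (+ 2 * c₃ + + 3 * c₄) - + 3 * c₄
              isolate = solve-∀
      form≡ℓ² : normForm c₁ c₂ ≡ + (ℓ ℕ.* ℓ)
      form≡ℓ² = ℤ.*-cancelˡ-≡ (+ 12) _ _ (sym (begin
        + 12 * + (ℓ ℕ.* ℓ)                                        ≡⟨ cong (+ 12 *_) (ℤ.pos-* ℓ ℓ) ⟩
        + 12 * (L * L)                                            ≡⟨ split ⟩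
        (B * B + + 3 * (Z * Z)) + P * (D * D + + 3 * (c₄ * c₄))
          ≡⟨ cong₂ (λ d v → (B * B + + 3 * (Z * Z)) + P * (d * d + + 3 * (v * v))) (D≡0∧c₄≡0 .proj₁) c₄≡0 ⟩
        (B * B + + 3 * (Z * Z)) + P * (+ 0 * + 0 + + 3 * (+ 0 * + 0)) ≡⟨ expand c₁ c₂ c₃ P ⟩
        + 12 * normForm c₁ c₂ + + 4 * c₃ * (+ 3 * c₂ + c₃)        ≡⟨ cong (λ c → + 12 * normForm c₁ c₂ + + 4 * c * (+ 3 * c₂ + c)) c₃≡0 ⟩
        + 12 * normForm c₁ c₂ + + 4 * + 0 * (+ 3 * c₂ + + 0)      ≡⟨ ℤ.+-identityʳ _ ⟩
        + 12 * normForm c₁ c₂                                     ∎))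
        where
        open ≡-Reasoning
        expand : ∀ c₁ c₂ c₃ P →
          ((+ 3 * c₂ + + 2 * c₃) * (+ 3 * c₂ + + 2 * c₃) + + 3 * ((+ 2 * c₁ + c₂) * (+ 2 * c₁ + c₂))) + P * (+ 0 * + 0 + + 3 * (+ 0 * + 0))
          ≡ + 12 * (c₁ * c₁ + c₁ * c₂ + c₂ * c₂) + + 4 * c₃ * (+ 3 * c₂ + c₃)
        expand = solve-∀

    SquareMinusP⇒A≡0 : Prime p → SquareMinusP → A ≡ + 0
    SquareMinusP⇒A≡0 pp (real , AB≡0 , AC≡0 , AD≡0) with A ℤ.≟ + 0
    ... | yes A≡0 = A≡0
    ... | no  A≢0 = ⊥-elim (A≢0 (∣x∣²+k∣y∣²≡0⇒x≡0∧y≡0 p {{prime⇒nonZero pp}} A (+ 6 * L) (ℤ.+-injective (begin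
      + (∣ A ∣² ℕ.+ p ℕ.* ∣ + 6 * L ∣²)                     ≡⟨ +[∣x∣²+k∣y∣²]≡x²+ky² p A (+ 6 * L) ⟩
      A * A + P * M                                         ≡⟨ isolate A B C D P M ⟩
      (A * A - + 3 * B * B - P * C * C - + 3 * P * D * D) + P * M + (+ 3 * B * B + P * C * C + + 3 * P * D * D)
                                                            ≡⟨ cong₂ (λ r s → r + P * M + s) real BCD≡0 ⟩
      - (P * M) + P * M + + 0                               ≡⟨ cancel (P * M) ⟩
      + 0                                                   ∎)) .proj₁))
      where
      open ≡-Reasoning
      M : ℤ
      M = (+ 6 * L) * (+ 6 * L)
      other-factor≡0 : ∀ {X} → A * X ≡ + 0 → X ≡ + 0
      other-factor≡0 AX≡0 with ℤ.i*j≡0⇒i≡0∨j≡0 A AX≡0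
      ... | inj₁ A≡0 = ⊥-elim (A≢0 A≡0)
      ... | inj₂ X≡0 = X≡0
      vanishes : ∀ P {b c d} → b ≡ + 0 → c ≡ + 0 → d ≡ + 0 → + 3 * b * b + P * c * c + + 3 * P * d * d ≡ + 0
      vanishes P refl refl refl = zeros P
        where zeros : ∀ P → + 3 * + 0 * + 0 + P * + 0 * + 0 + + 3 * P * + 0 * + 0 ≡ + 0
              zeros = solve-∀
      BCD≡0 : + 3 * B * B + P * C * C + + 3 * P * D * D ≡ + 0
      BCD≡0 = vanishes P (other-factor≡0 AB≡0) (other-factor≡0 AC≡0) (other-factor≡0 AD≡0)
      isolate : ∀ A B C D P M → A * A + P * M ≡ (A * A - + 3 * B * B - P * C * C - + 3 * P * D * D) + P * M + (+ 3 * B * B + P * C * C + + 3 * P * D * D)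
      isolate = solve-∀
      cancel : ∀ M → - M + M + + 0 ≡ + 0
      cancel = solve-∀

    -- B = A + 2T and C² + 3D² = 4 · 3 Q, so -(A² - 3B² - pC² - 3pD²) = 12 (T² + pQ) + A (12 T + 2 A)
    SquareMinusP⇒T²+PQ≡3PL² : Prime p → SquareMinusP → T * T + P * Q ≡ + 3 * P * (L * L)
    SquareMinusP⇒T²+PQ≡3PL² pp sq@(real , _) = ℤ.*-cancelˡ-≡ (+ 12) _ _ (begin
      + 12 * (T * T + P * Q)                                ≡⟨ ℤ.+-identityʳ _ ⟨
      + 12 * (T * T + P * Q) + + 0 * (+ 12 * T + + 2 * A)   ≡⟨ cong (λ a → + 12 * (T * T + P * Q) + a * (+ 12 * T + + 2 * a)) (SquareMinusP⇒A≡0 pp sq) ⟨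
      + 12 * (T * T + P * Q) + A * (+ 12 * T + + 2 * A)     ≡⟨ expand c₁ c₂ c₃ c₄ P ⟩
      - (A * A - + 3 * B * B - P * C * C - + 3 * P * D * D) ≡⟨ cong -_ real ⟩
      - - (P * ((+ 6 * L) * (+ 6 * L)))                     ≡⟨ collect P L ⟩
      + 12 * (+ 3 * P * (L * L))                            ∎)
      where
      open ≡-Reasoning
      expand : ∀ c₁ c₂ c₃ c₄ P →
        + 12 * ((c₃ - + 3 * c₁) * (c₃ - + 3 * c₁) + P * (c₃ * c₃ + + 3 * c₃ * c₄ + + 3 * c₄ * c₄))
          + (+ 6 * c₁ + + 3 * c₂) * (+ 12 * (c₃ - + 3 * c₁) + + 2 * (+ 6 * c₁ + + 3 * c₂))
        ≡ - ((+ 6 * c₁ + + 3 * c₂) * (+ 6 * c₁ + + 3 * c₂) - + 3 * (+ 3 * c₂ + + 2 * c₃) * (+ 3 * c₂ + + 2 * c₃)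
             - P * (+ 3 * c₄) * (+ 3 * c₄) - + 3 * P * (+ 2 * c₃ + + 3 * c₄) * (+ 2 * c₃ + + 3 * c₄))
      expand = solve-∀
      collect : ∀ P L → - - (P * ((+ 6 * L) * (+ 6 * L))) ≡ + 12 * (+ 3 * P * (L * L))
      collect = solve-∀

    -- p ∣ T, and writing T = t p gives 4 p t² + (D² + 3 c₄²) = 12 ℓ² < 4 p, so t = 0
    T²+PQ≡3PL²⇒T≡0∧Q≡3L² : Prime p → 3 ℕ.* (ℓ ℕ.* ℓ) ℕ.< p → T * T + P * Q ≡ + 3 * P * (L * L) → T ≡ + 0 × Q ≡ + 3 * (L * L)
    T²+PQ≡3PL²⇒T≡0∧Q≡3L² pp 3ℓ²<p T²+PQ≡ = T≡0 , Q≡3L²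
      where
      instance _ = prime⇒nonZero pp
      P∣T : P ∣ₛ T
      P∣T = prime∣²⇒∣ pp T (divides (+ 3 * (L * L) - Q) (begin
        T * T                               ≡⟨ isolate T P Q ⟩
        (T * T + P * Q) - P * Q             ≡⟨ cong (_- P * Q) T²+PQ≡ ⟩
        + 3 * P * (L * L) - P * Q           ≡⟨ factor P Q L ⟩
        (+ 3 * (L * L) - Q) * P             ∎))
        where
        open ≡-Reasoning
        isolate : ∀ T P Q → T * T ≡ (T * T + P * Q) - P * Q
        isolate = solve-∀
        factor : ∀ P Q L → + 3 * P * (L * L) - P * Q ≡ (+ 3 * (L * L) - Q) * P
        factor = solve-∀
      t : ℤ
      t = _∣ₛ_.quotient P∣T
      T≡tP : T ≡ t * P
      T≡tP = _∣ₛ_.equality P∣T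
      Pt²+Q≡3L² : P * (t * t) + Q ≡ + 3 * (L * L)
      Pt²+Q≡3L² = ℤ.*-cancelˡ-≡ P _ _ (begin
        P * (P * (t * t) + Q)      ≡⟨ expand t Q P ⟩
        (t * P) * (t * P) + P * Q  ≡⟨ cong (λ z → z * z + P * Q) T≡tP ⟨
        T * T + P * Q              ≡⟨ T²+PQ≡ ⟩
        + 3 * P * (L * L)          ≡⟨ ℤ.*-assoc (+ 3) P (L * L) ⟩
        + 3 * (P * (L * L))        ≡⟨ commute (+ 3) P (L * L) ⟩
        P * (+ 3 * (L * L))        ∎)
        where
        open ≡-Reasoning
        expand : ∀ t Q P → P * (P * (t * t) + Q) ≡ (t * P) * (t * P) + P * Q
        expand = solve-∀
        commute : ∀ a P M → a * (P * M) ≡ P * (a * M)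
        commute = solve-∀
      N : ℕ
      N = ∣ D ∣² ℕ.+ 3 ℕ.* ∣ c₄ ∣²
      boundℕ : 12 ℕ.* (ℓ ℕ.* ℓ) ≡ N ℕ.+ (4 ℕ.* p) ℕ.* ∣ t ∣²
      boundℕ = ℤ.+-injective (begin
        + (12 ℕ.* (ℓ ℕ.* ℓ))                  ≡⟨ trans (ℤ.pos-* 12 (ℓ ℕ.* ℓ)) (cong (+ 12 *_) (ℤ.pos-* ℓ ℓ)) ⟩
        + 12 * (L * L)                        ≡⟨ times4 L ⟩
        + 4 * (+ 3 * (L * L))                 ≡⟨ cong (+ 4 *_) Pt²+Q≡3L² ⟨
        + 4 * (P * (t * t) + Q)               ≡⟨ expand t c₃ c₄ P ⟩
        (D * D + + 3 * (c₄ * c₄)) + + 4 * P * (t * t)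
          ≡⟨ cong₂ (λ u v → u + + 4 * P * v) (+[∣x∣²+k∣y∣²]≡x²+ky² 3 D c₄) (+∣z∣²≡z*z t) ⟨
        + N + + 4 * P * + ∣ t ∣²               ≡⟨ trans (ℤ.pos-+ N _) (cong (_+_ (+ N)) (trans (ℤ.pos-* (4 ℕ.* p) ∣ t ∣²) (cong (_* + ∣ t ∣²) (ℤ.pos-* 4 p)))) ⟨
        + (N ℕ.+ (4 ℕ.* p) ℕ.* ∣ t ∣²)          ∎)
        where
        open ≡-Reasoning
        expand : ∀ t c₃ c₄ P → + 4 * (P * (t * t) + (c₃ * c₃ + + 3 * c₃ * c₄ + + 3 * c₄ * c₄))
                              ≡ ((+ 2 * c₃ + + 3 * c₄) * (+ 2 * c₃ + + 3 * c₄) + + 3 * (c₄ * c₄)) + + 4 * P * (t * t)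
        expand = solve-∀
        times4 : ∀ L → + 12 * (L * L) ≡ + 4 * (+ 3 * (L * L))
        times4 = solve-∀
      12ℓ²<4p : 12 ℕ.* (ℓ ℕ.* ℓ) ℕ.< (4 ℕ.* p) ℕ.* 1
      12ℓ²<4p = subst₂ ℕ._<_ (sym (ℕ.*-assoc 4 3 (ℓ ℕ.* ℓ))) (sym (ℕ.*-identityʳ (4 ℕ.* p))) (ℕ.*-monoʳ-< 4 3ℓ²<p)
      t≡0 : t ≡ + 0
      t≡0 = ∣z∣²≡0⇒z≡0 t (m≡o+n*k⇒k≡0 {n = 4 ℕ.* p} N ∣ t ∣² 12ℓ²<4p (ℕ.1∣ ∣ t ∣²) boundℕ)
      T≡0 : T ≡ + 0
      T≡0 = trans T≡tP (trans (cong (_* P) t≡0) (ℤ.*-zeroˡ P))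
      Q≡3L² : Q ≡ + 3 * (L * L)
      Q≡3L² = begin
        Q                        ≡⟨ pad P Q ⟩
        P * (+ 0 * + 0) + Q      ≡⟨ cong (λ z → P * (z * z) + Q) t≡0 ⟨
        P * (t * t) + Q          ≡⟨ Pt²+Q≡3L² ⟩
        + 3 * (L * L)            ∎
        where
        open ≡-Reasoning
        pad : ∀ P Q → Q ≡ P * (+ 0 * + 0) + Q
        pad = solve-∀

    SquareMinusP⇒ : Prime p → 3 ℕ.* (ℓ ℕ.* ℓ) ℕ.< p → SquareMinusP →
      c₂ ≡ - (+ 2 * c₁) × c₃ ≡ + 3 * c₁ × normForm (- c₁) (c₄ + + 2 * c₁) ≡ + (ℓ ℕ.* ℓ)
    SquareMinusP⇒ pp 3ℓ²<p sq = c₂≡-2c₁ , c₃≡3c₁ , form≡ℓ²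
      where
      T≡0∧Q≡3L² : T ≡ + 0 × Q ≡ + 3 * (L * L)
      T≡0∧Q≡3L² = T²+PQ≡3PL²⇒T≡0∧Q≡3L² pp 3ℓ²<p (SquareMinusP⇒T²+PQ≡3PL² pp sq)
      c₂≡-2c₁ : c₂ ≡ - (+ 2 * c₁)
      c₂≡-2c₁ = ℤ.*-cancelˡ-≡ (+ 3) _ _ (trans (shift c₁ c₂) (trans (cong (_- + 6 * c₁) (SquareMinusP⇒A≡0 pp sq)) (tidy c₁)))
        where shift : ∀ c₁ c₂ → + 3 * c₂ ≡ (+ 6 * c₁ + + 3 * c₂) - + 6 * c₁
              shift = solve-∀
              tidy : ∀ c₁ → + 0 - + 6 * c₁ ≡ + 3 * - (+ 2 * c₁)
              tidy = solve-∀
      c₃≡3c₁ : c₃ ≡ + 3 * c₁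
      c₃≡3c₁ = trans (shift c₃ c₁) (trans (cong (_+ + 3 * c₁) (T≡0∧Q≡3L² .proj₁)) (ℤ.+-identityˡ _))
        where shift : ∀ c₃ c₁ → c₃ ≡ (c₃ - + 3 * c₁) + + 3 * c₁
              shift = solve-∀
      form≡ℓ² : normForm (- c₁) (c₄ + + 2 * c₁) ≡ + (ℓ ℕ.* ℓ)
      form≡ℓ² = ℤ.*-cancelˡ-≡ (+ 3) _ _ (begin
        + 3 * normForm (- c₁) (c₄ + + 2 * c₁)                       ≡⟨ expand c₁ c₄ ⟩
        (+ 3 * c₁) * (+ 3 * c₁) + + 3 * (+ 3 * c₁) * c₄ + + 3 * c₄ * c₄ ≡⟨ cong (λ c → c * c + + 3 * c * c₄ + + 3 * c₄ * c₄) c₃≡3c₁ ⟨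
        Q                                                           ≡⟨ T≡0∧Q≡3L² .proj₂ ⟩
        + 3 * (L * L)                                               ≡⟨ cong (+ 3 *_) (ℤ.pos-* ℓ ℓ) ⟨
        + 3 * + (ℓ ℕ.* ℓ)                                           ∎)
        where
        open ≡-Reasoning
        expand : ∀ c₁ c₄ → + 3 * ((- c₁) * (- c₁) + (- c₁) * (c₄ + + 2 * c₁) + (c₄ + + 2 * c₁) * (c₄ + + 2 * c₁))
                           ≡ (+ 3 * c₁) * (+ 3 * c₁) + + 3 * (+ 3 * c₁) * c₄ + + 3 * c₄ * c₄
        expand = solve-∀

module OrderElements where

  open import Defs
  open Fractions
  open QuaternionCoordinates
  open EisensteinNorm using (normForm; EisensteinUnit; +𝟙; -𝟙; +ε; -ε; +ε̄; -ε̄; _·c; normForm≡ℓ²⇒primitive⊎unitMultiple)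
  open OrderEquations using (module NormEquations; module IntegerSolutions)
  open import Data.Nat as ℕ using (ℕ; suc)
  open import Data.Nat.DivMod using (_%_)
  open import Data.Nat.Primality using (Prime; prime⇒nonZero)
  open import Data.Integer as ℤ using (ℤ; +_; -[1+_]; _+_; _*_; -_; _-_)
  import Data.Integer.Properties as ℤ
  open import Data.Integer.Divisibility using (_∣_)
  open import Data.Integer.Tactic.RingSolver using (solve; solve-∀)
  open import Data.Rational as ℚ using (1ℚ)
  open import Data.List using (_∷_; [])
  open import Data.Product using (Σ; _×_; _,_)
  open import Data.Sum using (_⊎_; inj₁; inj₂)
  open import Data.Empty using (⊥-elim)
  open import Relation.Nullary using (¬_)
  open import Relation.Binary.PropositionalEquality

  fraction-inv : ∀ ℓ .{{_ : ℕ.NonZero ℓ}} → Fraction (inv ℓ) (+ 1) (+ ℓ)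
  fraction-inv (suc n) = fraction-/ (+ 1) n

  𝒪⟨_,_,_,_⟩ : ℤ → ℤ → ℤ → ℤ → Quat
  𝒪⟨ c₁ , c₂ , c₃ , c₄ ⟩ = (((ℤ→ℚ c₁ · 𝟙) ⊕ (ℤ→ℚ c₂ · ε)) ⊕ (ℤ→ℚ c₃ · b₃)) ⊕ (ℤ→ℚ c₄ · b₄)

  Unit[ε] : Quat → Set
  Unit[ε] μ = μ ≡ 𝟙 ⊎ μ ≡ neg 𝟙 ⊎ μ ≡ ε ⊎ μ ≡ neg ε ⊎ μ ≡ ε̄ ⊎ μ ≡ neg ε̄

  Unit[ε]𝕛 : ℕ → Quat → Set
  Unit[ε]𝕛 p s = s ≡ 𝕛 ⊎ s ≡ neg 𝕛 ⊎ s ≡ mul p ε 𝕛 ⊎ s ≡ neg (mul p ε 𝕛) ⊎ s ≡ mul p ε̄ 𝕛 ⊎ s ≡ neg (mul p ε̄ 𝕛)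

  xyε-unit : ∀ {x y} → EisensteinUnit x y → Unit[ε] (xyε x y)
  xyε-unit +𝟙 = inj₁ (coordinates-injective (coordinates-xyε (+ 1) (+ 0)) coordinates-𝟙 refl refl refl refl)
  xyε-unit -𝟙 = inj₂ (inj₁ (coordinates-injective (coordinates-xyε -[1+ 0 ] (+ 0)) (coordinates-neg coordinates-𝟙) refl refl refl refl))
  xyε-unit +ε = inj₂ (inj₂ (inj₁ (coordinates-injective (coordinates-xyε (+ 0) (+ 1)) coordinates-ε refl refl refl refl)))
  xyε-unit -ε = inj₂ (inj₂ (inj₂ (inj₁ (coordinates-injective (coordinates-xyε (+ 0) -[1+ 0 ]) (coordinates-neg coordinates-ε) refl refl refl refl))))
  xyε-unit +ε̄ = inj₂ (inj₂ (inj₂ (inj₂ (inj₁ (coordinates-injective (coordinates-xyε (+ 1) -[1+ 0 ]) coordinates-ε̄ refl refl refl refl)))))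
  xyε-unit -ε̄ = inj₂ (inj₂ (inj₂ (inj₂ (inj₂ (coordinates-injective (coordinates-xyε -[1+ 0 ] (+ 1)) (coordinates-neg coordinates-ε̄) refl refl refl refl)))))

  -- P and L are variables, not + p and + ℓ, so that the ring solver treats them as atoms.
  module ScaledOrder (p ℓ : ℕ) {P L : ℤ} (fP : Fraction (ℤ→ℚ (+ p)) P (+ 1)) (fL : Fraction (inv ℓ) (+ 1) L) where
    open NormEquations P L

    L≢0 : ℤ.NonZero L
    L≢0 = denominator≢0 fL

    coordinates-ℓ⁻¹𝒪 : ∀ c₁ c₂ c₃ c₄ → Coordinates (inv ℓ · 𝒪⟨ c₁ , c₂ , c₃ , c₄ ⟩)
      (+ 6 * c₁ + + 3 * c₂) (+ 3 * c₂ + + 2 * c₃) (+ 3 * c₄) (+ 2 * c₃ + + 3 * c₄) (+ 6 * L)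
    coordinates-ℓ⁻¹𝒪 c₁ c₂ c₃ c₄ = coordinates-rescale
      (coordinates-· fL (coordinates-⊕ (coordinates-⊕ (coordinates-⊕
        (coordinates-· (fraction-ℤ c₁) coordinates-𝟙) (coordinates-· (fraction-ℤ c₂) coordinates-ε))
        (coordinates-· (fraction-ℤ c₃) coordinates-b₃)) (coordinates-· (fraction-ℤ c₄) coordinates-b₄)))
      (solve (c₁ ∷ c₂ ∷ c₃ ∷ c₄ ∷ L ∷ [])) (solve (c₁ ∷ c₂ ∷ c₃ ∷ c₄ ∷ L ∷ []))
      (solve (c₁ ∷ c₂ ∷ c₃ ∷ c₄ ∷ L ∷ [])) (solve (c₁ ∷ c₂ ∷ c₃ ∷ c₄ ∷ L ∷ []))
      (ℤ.i*j≢0 (+ 6) L {{_}} {{L≢0}})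

    coordinates-ℓ⁻¹xyε : ∀ x y → Coordinates (inv ℓ · xyε x y) (+ 2 * x + y) y (+ 0) (+ 0) (+ 2 * L)
    coordinates-ℓ⁻¹xyε x y = coordinates-rescale (coordinates-· fL (coordinates-xyε x y))
      (solve (x ∷ y ∷ L ∷ [])) (solve (x ∷ y ∷ L ∷ [])) (solve (x ∷ y ∷ L ∷ [])) (solve (x ∷ y ∷ L ∷ []))
      (ℤ.i*j≢0 (+ 2) L {{_}} {{L≢0}})

    Nrd≡1⇒NormOne : ∀ c₁ c₂ c₃ c₄ → Nrd p (inv ℓ · 𝒪⟨ c₁ , c₂ , c₃ , c₄ ⟩) ≡ 1ℚ → NormOne c₁ c₂ c₃ c₄
    Nrd≡1⇒NormOne c₁ c₂ c₃ c₄ Nrd≡1 = trans (sym (ℤ.*-identityʳ _)) (trans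
      (fraction-cross (fraction-Nrd p fP (coordinates-ℓ⁻¹𝒪 c₁ c₂ c₃ c₄)) (subst (λ q → Fraction q (+ 1) (+ 1)) (sym Nrd≡1) fraction-1))
      (ℤ.*-identityˡ _))

    square≡-p⇒SquareMinusP : ∀ c₁ c₂ c₃ c₄ → let μ = inv ℓ · 𝒪⟨ c₁ , c₂ , c₃ , c₄ ⟩ in
      mul p μ μ ≡ sc (ℚ.- ℤ→ℚ (+ p)) → SquareMinusP c₁ c₂ c₃ c₄
    square≡-p⇒SquareMinusP c₁ c₂ c₃ c₄ μ²≡-p = split (coordinates-cross
      (coordinates-mul p fP (coordinates-ℓ⁻¹𝒪 c₁ c₂ c₃ c₄) (coordinates-ℓ⁻¹𝒪 c₁ c₂ c₃ c₄))
      (subst (λ u → Coordinates u (- P) (+ 0) (+ 0) (+ 0) (+ 1)) (sym μ²≡-p) (coordinates-sc (fraction-neg fP))))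
      where
      a b c d M : ℤ
      a = A c₁ c₂ c₃ c₄
      b = B c₁ c₂ c₃ c₄
      c = C c₁ c₂ c₃ c₄
      d = D c₁ c₂ c₃ c₄
      M = (+ 6 * L) * (+ 6 * L)
      double≡0 : ∀ {n X} → n ≡ + 2 * X → n * + 1 ≡ + 0 * M → X ≡ + 0
      double≡0 {n} {X} n≡2X n≡0 = ℤ.*-cancelˡ-≡ (+ 2) X (+ 0) (trans (sym n≡2X) (trans (sym (ℤ.*-identityʳ n)) n≡0))
      i-part : ∀ A B C D P → A * B + B * A + P * C * D - P * D * C ≡ + 2 * (A * B)
      i-part = solve-∀
      j-part : ∀ A B C D → A * C + C * A - + 3 * B * D + + 3 * D * B ≡ + 2 * (A * C)
      j-part = solve-∀
      k-part : ∀ A B C D → A * D + D * A + B * C - C * B ≡ + 2 * (A * D)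
      k-part = solve-∀
      split : (a * a - + 3 * b * b - P * c * c - + 3 * P * d * d) * + 1 ≡ - P * M
            × (a * b + b * a + P * c * d - P * d * c) * + 1 ≡ + 0 * M
            × (a * c + c * a - + 3 * b * d + + 3 * d * b) * + 1 ≡ + 0 * M
            × (a * d + d * a + b * c - c * b) * + 1 ≡ + 0 * M
            → SquareMinusP c₁ c₂ c₃ c₄
      split (real , i , j , k) =
        trans (sym (ℤ.*-identityʳ _)) (trans real (sym (ℤ.neg-distribˡ-* P M))) ,
        double≡0 (i-part a b c d P) i , double≡0 (j-part a b c d) j , double≡0 (k-part a b c d) k

    ℓ⁻¹𝒪⟨c₁,c₂,0,0⟩ : ∀ c₁ c₂ → inv ℓ · 𝒪⟨ c₁ , c₂ , + 0 , + 0 ⟩ ≡ inv ℓ · xyε c₁ c₂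
    ℓ⁻¹𝒪⟨c₁,c₂,0,0⟩ c₁ c₂ = coordinates-injective (coordinates-ℓ⁻¹𝒪 c₁ c₂ (+ 0) (+ 0)) (coordinates-ℓ⁻¹xyε c₁ c₂)
      (solve (c₁ ∷ c₂ ∷ L ∷ [])) (solve (c₁ ∷ c₂ ∷ L ∷ [])) (solve (c₁ ∷ c₂ ∷ L ∷ [])) (solve (c₁ ∷ c₂ ∷ L ∷ []))

    coordinates-[a+bi]𝕛 : ∀ {u a b D} → Coordinates u a b (+ 0) (+ 0) D → Coordinates (mul p u 𝕛) (+ 0) (+ 0) a b D
    coordinates-[a+bi]𝕛 {a = a} {b} {D} cu = coordinates-rescale (coordinates-mul p fP cu coordinates-𝕛)
      (solve (a ∷ b ∷ D ∷ P ∷ [])) (solve (a ∷ b ∷ D ∷ P ∷ [])) (solve (a ∷ b ∷ D ∷ P ∷ [])) (solve (a ∷ b ∷ D ∷ P ∷ []))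
      (denominator≢0 (re≡ cu))

    ℓ⁻¹𝒪⟨c₁,-2c₁,3c₁,c₄⟩ : ∀ c₁ c₄ →
      inv ℓ · 𝒪⟨ c₁ , - (+ 2 * c₁) , + 3 * c₁ , c₄ ⟩ ≡ mul p (inv ℓ · xyε (- c₁) (c₄ + + 2 * c₁)) 𝕛
    ℓ⁻¹𝒪⟨c₁,-2c₁,3c₁,c₄⟩ c₁ c₄ = coordinates-injective (coordinates-ℓ⁻¹𝒪 c₁ (- (+ 2 * c₁)) (+ 3 * c₁) c₄)
      (coordinates-[a+bi]𝕛 (coordinates-ℓ⁻¹xyε (- c₁) (c₄ + + 2 * c₁)))
      (solve (c₁ ∷ c₄ ∷ L ∷ [])) (solve (c₁ ∷ c₄ ∷ L ∷ [])) (solve (c₁ ∷ c₄ ∷ L ∷ [])) (solve (c₁ ∷ c₄ ∷ L ∷ []))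

    ℓ⁻¹xyε[xL,yL] : ∀ x y → inv ℓ · xyε (x * L) (y * L) ≡ xyε x y
    ℓ⁻¹xyε[xL,yL] x y = coordinates-injective (coordinates-ℓ⁻¹xyε (x * L) (y * L)) (coordinates-xyε x y)
      (solve (x ∷ y ∷ L ∷ [])) (solve (x ∷ y ∷ L ∷ [])) (solve (x ∷ y ∷ L ∷ [])) (solve (x ∷ y ∷ L ∷ []))

    private
      xyε𝕛 : ∀ x y → Coordinates (mul p (xyε x y) 𝕛) (+ 0) (+ 0) (+ 2 * x + y) y (+ 2)
      xyε𝕛 x y = coordinates-[a+bi]𝕛 (coordinates-xyε x y)
      ε𝕛 : Coordinates (mul p ε 𝕛) (+ 0) (+ 0) (+ 1) (+ 1) (+ 2)
      ε𝕛 = coordinates-[a+bi]𝕛 coordinates-ε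
      ε̄𝕛 : Coordinates (mul p ε̄ 𝕛) (+ 0) (+ 0) (+ 1) (- + 1) (+ 2)
      ε̄𝕛 = coordinates-[a+bi]𝕛 coordinates-ε̄

    xyε𝕛-unit : ∀ {x y} → EisensteinUnit x y → Unit[ε]𝕛 p (mul p (xyε x y) 𝕛)
    xyε𝕛-unit +𝟙 = inj₁ (coordinates-injective (xyε𝕛 (+ 1) (+ 0)) coordinates-𝕛 refl refl refl refl)
    xyε𝕛-unit -𝟙 = inj₂ (inj₁ (coordinates-injective (xyε𝕛 -[1+ 0 ] (+ 0)) (coordinates-neg coordinates-𝕛) refl refl refl refl))
    xyε𝕛-unit +ε = inj₂ (inj₂ (inj₁ (coordinates-injective (xyε𝕛 (+ 0) (+ 1)) ε𝕛 refl refl refl refl)))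
    xyε𝕛-unit -ε = inj₂ (inj₂ (inj₂ (inj₁ (coordinates-injective (xyε𝕛 (+ 0) -[1+ 0 ]) (coordinates-neg ε𝕛) refl refl refl refl))))
    xyε𝕛-unit +ε̄ = inj₂ (inj₂ (inj₂ (inj₂ (inj₁ (coordinates-injective (xyε𝕛 (+ 1) -[1+ 0 ]) ε̄𝕛 refl refl refl refl)))))
    xyε𝕛-unit -ε̄ = inj₂ (inj₂ (inj₂ (inj₂ (inj₂ (coordinates-injective (xyε𝕛 -[1+ 0 ] (+ 1)) (coordinates-neg ε̄𝕛) refl refl refl refl)))))

  NormSolution : ℕ → (ℤ → ℤ → Quat) → Quat → Set
  NormSolution ℓ f μ = Σ ℤ λ x → Σ ℤ λ y → (μ ≡ f x y) × (normForm x y ≡ + (ℓ ℕ.* ℓ))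

  PrimitiveNormSolution : ℕ → (ℤ → ℤ → Quat) → Quat → Set
  PrimitiveNormSolution ℓ f μ = (ℓ % 3 ≡ 1) × (Σ ℤ λ x → Σ ℤ λ y → (μ ≡ f x y) × ¬ (+ ℓ ∣ x) × (normForm x y ≡ + (ℓ ℕ.* ℓ)))

  normSolution⇒primitive : ∀ {ℓ} → Prime ℓ → (f : ℤ → ℤ → Quat) (Excluded : Quat → Set) →
    (∀ {x y} → EisensteinUnit x y → Excluded (f (x * + ℓ) (y * + ℓ))) →
    ∀ {μ} → NormSolution ℓ f μ → ¬ Excluded μ → PrimitiveNormSolution ℓ f μ
  normSolution⇒primitive pℓ f Excluded unit⇒excluded (x , y , μ≡fxy , form≡ℓ²) μ∉
    with normForm≡ℓ²⇒primitive⊎unitMultiple pℓ x y form≡ℓ²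
  ... | inj₁ (ℓ≡1[3] , ℓ∤x) = ℓ≡1[3] , x , y , μ≡fxy , ℓ∤x , form≡ℓ²
  ... | inj₂ (u ·c)          = ⊥-elim (μ∉ (subst Excluded (sym μ≡fxy) (unit⇒excluded u)))

  module _ (p : ℕ) {ℓ : ℕ} (pℓ : Prime ℓ) where
    private instance _ = prime⇒nonZero pℓ
    open ScaledOrder p ℓ (fraction-ℤ (+ p)) (fraction-inv ℓ)

    Nrd≡1⇒normSolution : 3 ℕ.* (ℓ ℕ.* ℓ) ℕ.< p → ∀ {μ} → InℓinvO ℓ μ → Nrd p μ ≡ 1ℚ →
      NormSolution ℓ (λ x y → inv ℓ · xyε x y) μ
    Nrd≡1⇒normSolution 3ℓ²<p (_ , (c₁ , c₂ , c₃ , c₄ , refl) , refl) Nrd≡1 =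
      shape c₁ c₂ c₃ c₄ (IntegerSolutions.NormOne⇒ p ℓ c₁ c₂ c₃ c₄ 3ℓ²<p (Nrd≡1⇒NormOne c₁ c₂ c₃ c₄ Nrd≡1))
      where
      shape : ∀ c₁ c₂ c₃ c₄ → c₃ ≡ + 0 × c₄ ≡ + 0 × normForm c₁ c₂ ≡ + (ℓ ℕ.* ℓ) →
        NormSolution ℓ (λ x y → inv ℓ · xyε x y) (inv ℓ · 𝒪⟨ c₁ , c₂ , c₃ , c₄ ⟩)
      shape c₁ c₂ _ _ (refl , refl , form≡ℓ²) = c₁ , c₂ , ℓ⁻¹𝒪⟨c₁,c₂,0,0⟩ c₁ c₂ , form≡ℓ²

    square≡-p⇒normSolution : Prime p → 3 ℕ.* (ℓ ℕ.* ℓ) ℕ.< p → ∀ {s} → InℓinvO ℓ s → mul p s s ≡ sc (ℚ.- ℤ→ℚ (+ p)) →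
      NormSolution ℓ (λ x y → mul p (inv ℓ · xyε x y) 𝕛) s
    square≡-p⇒normSolution pp 3ℓ²<p (_ , (c₁ , c₂ , c₃ , c₄ , refl) , refl) s²≡-p =
      shape c₁ c₂ c₃ c₄ (IntegerSolutions.SquareMinusP⇒ p ℓ c₁ c₂ c₃ c₄ pp 3ℓ²<p (square≡-p⇒SquareMinusP c₁ c₂ c₃ c₄ s²≡-p))
      where
      shape : ∀ c₁ c₂ c₃ c₄ → c₂ ≡ - (+ 2 * c₁) × c₃ ≡ + 3 * c₁ × normForm (- c₁) (c₄ + + 2 * c₁) ≡ + (ℓ ℕ.* ℓ) →
        NormSolution ℓ (λ x y → mul p (inv ℓ · xyε x y) 𝕛) (inv ℓ · 𝒪⟨ c₁ , c₂ , c₃ , c₄ ⟩)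
      shape c₁ _ _ c₄ (refl , refl , form≡ℓ²) = - c₁ , c₄ + + 2 * c₁ , ℓ⁻¹𝒪⟨c₁,-2c₁,3c₁,c₄⟩ c₁ c₄ , form≡ℓ²

    scaled-unit : ∀ {x y} → EisensteinUnit x y → Unit[ε] (inv ℓ · xyε (x * + ℓ) (y * + ℓ))
    scaled-unit {x} {y} u = subst Unit[ε] (sym (ℓ⁻¹xyε[xL,yL] x y)) (xyε-unit u)

    scaled-unit𝕛 : ∀ {x y} → EisensteinUnit x y → Unit[ε]𝕛 p (mul p (inv ℓ · xyε (x * + ℓ) (y * + ℓ)) 𝕛)
    scaled-unit𝕛 {x} {y} u = subst (λ v → Unit[ε]𝕛 p (mul p v 𝕛)) (sym (ℓ⁻¹xyε[xL,yL] x y)) (xyε𝕛-unit u)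

open import Defs
open import Data.Nat using (ℕ; _%_; _<_; _*_)
open import Data.Nat.Primality using (Prime)
open import Data.Integer using (ℤ; +_)
open import Data.Integer.Divisibility using (_∣_)
open import Data.Rational using (1ℚ; -_)
open import Data.Product using (Σ; _×_; _,_)
open import Data.Sum using (_⊎_)
open import Relation.Nullary using (¬_)
open import Relation.Binary.PropositionalEquality using (_≡_)
open OrderElements

lemma3p5 : (p ℓ : ℕ) → Prime p → p % 3 ≡ 2 → Prime ℓ → 3 * (ℓ * ℓ) < p →
    ((μ : Quat) → InℓinvO ℓ μ → Nrd p μ ≡ 1ℚ →
      ¬ (μ ≡ 𝟙 ⊎ μ ≡ neg 𝟙 ⊎ μ ≡ ε ⊎ μ ≡ neg ε ⊎ μ ≡ ε̄ ⊎ μ ≡ neg ε̄) →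
      (ℓ % 3 ≡ 1) × (Σ ℤ λ x → Σ ℤ λ y →
        (μ ≡ inv ℓ · xyε x y) × ¬ ((+ ℓ) ∣ x) ×
        (x Data.Integer.* x Data.Integer.+ x Data.Integer.* y Data.Integer.+ y Data.Integer.* y ≡ + (ℓ * ℓ))))
    × ((s : Quat) → InℓinvO ℓ s → mul p s s ≡ sc (- ℤ→ℚ (+ p)) →
      ¬ (s ≡ 𝕛 ⊎ s ≡ neg 𝕛 ⊎ s ≡ mul p ε 𝕛 ⊎ s ≡ neg (mul p ε 𝕛) ⊎ s ≡ mul p ε̄ 𝕛 ⊎ s ≡ neg (mul p ε̄ 𝕛)) →
      (ℓ % 3 ≡ 1) × (Σ ℤ λ x → Σ ℤ λ y →
        (s ≡ mul p (inv ℓ · xyε x y) 𝕛) × ¬ ((+ ℓ) ∣ x) ×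
        (x Data.Integer.* x Data.Integer.+ x Data.Integer.* y Data.Integer.+ y Data.Integer.* y ≡ + (ℓ * ℓ))))
lemma3p5 p ℓ pp _ pℓ 3ℓ²<p = part₁ , part₂
  where
  part₁ : ∀ μ → InℓinvO ℓ μ → Nrd p μ ≡ 1ℚ → ¬ Unit[ε] μ → PrimitiveNormSolution ℓ (λ x y → inv ℓ · xyε x y) μ
  part₁ μ μ∈ℓ⁻¹𝒪 Nrd≡1 = normSolution⇒primitive pℓ _ Unit[ε] (scaled-unit p pℓ)
    (Nrd≡1⇒normSolution p pℓ 3ℓ²<p μ∈ℓ⁻¹𝒪 Nrd≡1)
  part₂ : ∀ s → InℓinvO ℓ s → mul p s s ≡ sc (- ℤ→ℚ (+ p)) → ¬ Unit[ε]𝕛 p s →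
    PrimitiveNormSolution ℓ (λ x y → mul p (inv ℓ · xyε x y) 𝕛) s
  part₂ s s∈ℓ⁻¹𝒪 s²≡-p = normSolution⇒primitive pℓ _ (Unit[ε]𝕛 p) (scaled-unit𝕛 p pℓ)
    (square≡-p⇒normSolution p pℓ pp 3ℓ²<p s∈ℓ⁻¹𝒪 s²≡-p)
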